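{- Let $p$ be a prime with $p \equiv 3 \pmod 4$ and let $d \in \mathbb{F}_p$ with $d \neq 0, 1$. Suppose that $$\sum_{j=0}^{\frac{p-1}{2}} \left(C_{\frac{p-1}{2}}^{j}\right)^{2} d^{j} \equiv 0 \pmod p.$$ Then the orders of the curves $x^2+y^2=1+dx^2y^2$ and $x^2+y^2=1+d^{ -1}x^2y^2$ over $\mathbb{F}_p$ are both equal to $p+1$ when $\left(\frac{d}{p}\right)=-1$, and both equal to $p-3$ when $\left(\frac{d}{p}\right)=1$.
   Context: For $d\in\mathbb{F}_p^*$, $d\neq 1$, the Edwards curve $E_d$ is $x^2+y^2=1+dx^2y^2$. The order of the curve $E_d$ over $\mathbb{F}_p$, denoted $N_{d[p]}$, is the number of affine solutions $(x,y)\in\mathbb{F}_p^2$ of this equation. $C_n^j$ denotes the binomial coefficient $\binom{n}{j}$ and $\left(\frac{d}{p}\right)$ the Legendre symbol. -}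

module Defs where

open import Data.Nat using (ℕ; zero; suc; _+_; _*_; _^_; _<_; _%_; _/_; _∸_)
open import Data.Nat.Combinatorics using (_C_)
open import Data.List using (List; upTo; map; filter; length; cartesianProduct)
open import Data.Nat.ListAction using (sum)
open import Relation.Nullary using (Dec)
open import Data.Product using (_×_; _,_; ∃-syntax)
open import Relation.Binary.PropositionalEquality using (_≡_)
open import Data.Nat.Properties using (_≟_)

-- Elements of F_p are represented by residues 0..p-1 (natural numbers < p).

onCurve : (p : ℕ) .{{_ : Data.Nat.NonZero p}} → ℕ → ℕ × ℕ → Set
onCurve p d (x , y) = (x * x + y * y) % p ≡ (1 + d * (x * x) * (y * y)) % p

onCurve? : (p : ℕ) .{{_ : Data.Nat.NonZero p}} → (d : ℕ) → (xy : ℕ × ℕ) → Dec (onCurve p d xy)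
onCurve? p d (x , y) = ((x * x + y * y) % p) ≟ ((1 + d * (x * x) * (y * y)) % p)

edwardsOrder : (p : ℕ) .{{_ : Data.Nat.NonZero p}} → ℕ → ℕ
edwardsOrder p d =
  length (filter (onCurve? p d) (cartesianProduct (upTo p) (upTo p)))

binomSum : ℕ → ℕ → ℕ
binomSum p d = sum (map (λ j → (m C j) * (m C j) * d ^ j) (upTo (suc m)))
  where m = (p ∸ 1) / 2

-- d is a nonzero quadratic residue mod p, i.e. Legendre symbol (d/p) = 1
-- (for d ≢ 0 mod p; otherwise (d/p) = -1).
IsSquare : (p : ℕ) .{{_ : Data.Nat.NonZero p}} → ℕ → Set
IsSquare p d = ∃[ y ] (y < p × (y * y) % p ≡ d % p)

-- Write p = 2m + 1 (p ≡ 3 mod 4 is only used to get m ≥ 1), u = 1 − d x² and v = 1 − x².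
-- The points of E_d over a fixed x are the y with u y² ≡ v. Since 1 − z^(p−1) is the
-- indicator of z ≡ 0 and ∑_y y^k ≡ 0 unless (p − 1) ∣ k > 0, their number is
-- ≡ (uv)^m + u^(2m) (mod p) (Chevalley–Warning); summing over x in the same way gives
--   N_d ≡ −(−1)^m S(d) − 2 d^m − 1,   S(d) = ∑_k C(m,k)² d^k.
-- With S(d) ≡ 0 and Euler's criterion d^m ≡ ±1 this is N_d ≡ 1 or N_d ≡ −3. Every fibre has
-- at most two points, the fibres over x = ±1 are {y = 0}, and if d = t² the fibres over
-- x = ±1/t are empty; this pins N_d down to p + 1, resp. p − 3. For d⁻¹ use the symmetry
-- C(m,k) = C(m,m−k), which gives d^m S(d⁻¹) ≡ S(d).

module Submission where

open import Defs

open import Data.Nat as ℕ using (ℕ; zero; suc; NonZero; z≤n; s≤s)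
import Data.Nat.Properties as ℕP
import Data.Nat.DivMod as ℕM
open import Data.Nat.Divisibility as ℕD using (divides)
open import Data.Nat.Primality using (Prime; euclidsLemma)
open import Data.Nat.Combinatorics
  using (_C_; nCn≡1; nC1≡n; k>n⇒nCk≡0; nCk≡nC[n∸k]; nCk+nC[k+1]≡[n+1]C[k+1])
import Data.Nat.Tactic.RingSolver as ℕ-Solver
open import Data.Integer as ℤ using (ℤ; +_; -[1+_]; _+_; _*_; -_; _-_; _^_; 0ℤ; 1ℤ; -1ℤ; ∣_∣)
import Data.Integer.Properties as ℤP
import Data.Integer.DivMod as ℤM
open import Data.Integer.Tactic.RingSolver using (solve-∀)
open import Data.Fin using (toℕ)
open import Data.Bool using (true; false; if_then_else_)
open import Data.List using (List; _∷_; _++_; map; filter; length; applyUpTo; upTo; cartesianProduct)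
open import Data.List.Properties using (filter-++; length-++; map-upTo)
open import Data.Nat.ListAction using (sum)
open import Data.Product using (∃-syntax; _×_; _,_; proj₁)
open import Data.Sum using (_⊎_; inj₁; inj₂)
open import Data.Empty using (⊥-elim)
open import Relation.Nullary using (¬_; Dec; yes; no; does)
open import Relation.Binary using (Setoid)
import Relation.Binary.Reasoning.Setoid
open import Relation.Binary.PropositionalEquality
open import Function using (_∘_)
open import Data.Nat.Induction using (<-rec)
import Algebra.Properties.CommutativeSemiring.Binomial ℤP.+-*-commutativeSemiring as Binomial
open import Algebra.Properties.Semiring.Exp ℤP.+-*-semiring using () renaming (_^_ to _^′_)
open import Algebra.Definitions.RawMonoid ℤ.+-0-rawMonoid using () renaming (sum to sumᶠ; _×_ to _×′_)

∑ : ℕ → (ℕ → ℤ) → ℤ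
∑ zero    f = 0ℤ
∑ (suc n) f = f 0 + ∑ n (f ∘ suc)

-- The body of ∑[ i < n ] stops at the first infix operator: parenthesise it.
syntax ∑ n (λ i → e) = ∑[ i < n ] e

∑ℕ : ℕ → (ℕ → ℕ) → ℕ
∑ℕ zero    f = 0
∑ℕ (suc n) f = f 0 ℕ.+ ∑ℕ n (f ∘ suc)

syntax ∑ℕ n (λ i → e) = ∑ℕ[ i < n ] e

∑-cong : ∀ {f g} n → (∀ i → i ℕ.< n → f i ≡ g i) → ∑ n f ≡ ∑ n g
∑-cong zero    eq = refl
∑-cong (suc n) eq = cong₂ _+_ (eq 0 (s≤s z≤n)) (∑-cong n (λ i i<n → eq (suc i) (s≤s i<n)))

∑-last : ∀ n f → ∑ (suc n) f ≡ ∑ n f + f n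
∑-last zero    f = ℤP.+-comm (f 0) 0ℤ
∑-last (suc n) f = trans (cong (_+_ (f 0)) (∑-last n (f ∘ suc))) (sym (ℤP.+-assoc (f 0) _ _))

∑-+ : ∀ n f g → ∑[ i < n ] (f i + g i) ≡ ∑ n f + ∑ n g
∑-+ zero    f g = refl
∑-+ (suc n) f g = trans (cong (_+_ (f 0 + g 0)) (∑-+ n (f ∘ suc) (g ∘ suc)))
                        (interchange (f 0) (g 0) (∑ n (f ∘ suc)) (∑ n (g ∘ suc)))
  where
  interchange : ∀ a b c d → a + b + (c + d) ≡ a + c + (b + d)
  interchange = solve-∀

∑-neg : ∀ n f → ∑[ i < n ] (- f i) ≡ - ∑ n f
∑-neg zero    f = refl
∑-neg (suc n) f = trans (cong (_+_ (- f 0)) (∑-neg n (f ∘ suc))) (sym (ℤP.neg-distrib-+ (f 0) _))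

∑-*ˡ : ∀ n c f → ∑[ i < n ] (c * f i) ≡ c * ∑ n f
∑-*ˡ zero    c f = sym (ℤP.*-zeroʳ c)
∑-*ˡ (suc n) c f = trans (cong (_+_ (c * f 0)) (∑-*ˡ n c (f ∘ suc))) (sym (ℤP.*-distribˡ-+ c (f 0) _))

∑-*ʳ : ∀ n c f → ∑[ i < n ] (f i * c) ≡ ∑ n f * c
∑-*ʳ n c f = trans (∑-cong n (λ i _ → ℤP.*-comm (f i) c)) (trans (∑-*ˡ n c f) (ℤP.*-comm c (∑ n f)))

∑-*-∑ : ∀ m n f g → ∑ m f * ∑ n g ≡ ∑[ i < m ] ∑[ j < n ] (f i * g j)
∑-*-∑ m n f g = trans (sym (∑-*ʳ m (∑ n g) f)) (∑-cong m (λ i _ → sym (∑-*ˡ n (f i) g)))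

∑-const : ∀ n c → ∑[ i < n ] c ≡ + n * c
∑-const zero    c = refl
∑-const (suc n) c = trans (cong (_+_ c) (∑-const n c)) (sym (ℤP.suc-* (+ n) c))

∑-zero : ∀ n → ∑[ i < n ] 0ℤ ≡ 0ℤ
∑-zero n = trans (∑-const n 0ℤ) (ℤP.*-zeroʳ (+ n))

∑-swap : ∀ m n (f : ℕ → ℕ → ℤ) → ∑[ i < m ] ∑[ j < n ] f i j ≡ ∑[ j < n ] ∑[ i < m ] f i j
∑-swap zero    n f = sym (∑-zero n)
∑-swap (suc m) n f = trans (cong (_+_ (∑[ j < n ] f 0 j)) (∑-swap m n (f ∘ suc)))
                           (sym (∑-+ n (f 0) (λ j → ∑[ i < m ] f (suc i) j)))

∑-telescope : ∀ n (g : ℕ → ℤ) → ∑[ i < n ] (g (suc i) - g i) ≡ g n - g 0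
∑-telescope zero    g = sym (ℤP.+-inverseʳ (g 0))
∑-telescope (suc n) g = trans (cong (_+_ (g 1 - g 0)) (∑-telescope n (g ∘ suc)))
                              (collapse (g 0) (g 1) (g (suc n)))
  where
  collapse : ∀ a b c → b - a + (c - b) ≡ c - a
  collapse = solve-∀

∑-reverse : ∀ n f → ∑ n f ≡ ∑[ i < n ] f (n ℕ.∸ suc i)
∑-reverse zero    f = refl
∑-reverse (suc n) f = begin
  ∑ (suc n) f                          ≡⟨ ∑-last n f ⟩
  ∑ n f + f n                          ≡⟨ cong (_+ f n) (∑-reverse n f) ⟩
  ∑[ i < n ] f (n ℕ.∸ suc i) + f n     ≡⟨ ℤP.+-comm _ (f n) ⟩
  f n + ∑[ i < n ] f (n ℕ.∸ suc i)     ∎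
  where open ≡-Reasoning

∑-pos : ∀ n f → + (∑ℕ n f) ≡ ∑[ i < n ] (+ f i)
∑-pos zero    f = refl
∑-pos (suc n) f = trans (ℤP.pos-+ (f 0) _) (cong (_+_ (+ f 0)) (∑-pos n (f ∘ suc)))

δ : ℕ → ℕ → ℤ
δ i j = if i ℕ.≡ᵇ j then 1ℤ else 0ℤ

δ-refl : ∀ i → δ i i ≡ 1ℤ
δ-refl zero    = refl
δ-refl (suc i) = δ-refl i

δ-≢ : ∀ {i j} → i ≢ j → δ i j ≡ 0ℤ
δ-≢ {zero}  {zero}  i≢j = ⊥-elim (i≢j refl)
δ-≢ {zero}  {suc j} i≢j = refl
δ-≢ {suc i} {zero}  i≢j = refl
δ-≢ {suc i} {suc j} i≢j = δ-≢ (i≢j ∘ cong suc)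

∑-δ : ∀ n (f : ℕ → ℤ) {j} → j ℕ.< n → ∑[ i < n ] (f i * δ i j) ≡ f j
∑-δ (suc n) f {zero}  _ = begin
  f 0 * 1ℤ + ∑[ i < n ] (f (suc i) * 0ℤ) ≡⟨ cong₂ _+_ (ℤP.*-identityʳ (f 0)) (∑-cong n (λ i _ → ℤP.*-zeroʳ (f (suc i)))) ⟩
  f 0 + ∑[ i < n ] 0ℤ                    ≡⟨ cong (_+_ (f 0)) (∑-zero n) ⟩
  f 0 + 0ℤ                               ≡⟨ ℤP.+-identityʳ (f 0) ⟩
  f 0                                    ∎
  where open ≡-Reasoning
∑-δ (suc n) f {suc j} (s≤s j<n) =
  trans (cong (_+ ∑[ i < n ] (f (suc i) * δ i j)) (ℤP.*-zeroʳ (f 0))) (trans (ℤP.+-identityˡ _) (∑-δ n (f ∘ suc) j<n))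

∑-−-− : ∀ n f g → ∑[ i < n ] (- f i - g i) ≡ - ∑ n f - ∑ n g
∑-−-− n f g = trans (∑-+ n (λ i → - f i) (λ i → - g i)) (cong₂ _+_ (∑-neg n f) (∑-neg n g))

δ-+ˡ : ∀ k i j → δ (k ℕ.+ i) (k ℕ.+ j) ≡ δ i j
δ-+ˡ zero    i j = refl
δ-+ˡ (suc k) i j = δ-+ˡ k i j

δ-+-+ : ∀ {n i j} → i ℕ.≤ n → j ℕ.≤ n → δ (i ℕ.+ j) (n ℕ.+ n) ≡ δ i n * δ j n
δ-+-+ {n} {i} {j} i≤n j≤n with i ℕ.≟ n
... | no i≢n = trans (δ-≢ (ℕP.<⇒≢ (ℕP.+-mono-<-≤ (ℕP.≤∧≢⇒< i≤n i≢n) j≤n))) (sym (cong (_* δ j n) (δ-≢ i≢n)))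
... | yes refl = trans (δ-+ˡ i j i) (sym (trans (cong (_* δ j i) (δ-refl i)) (ℤP.*-identityˡ (δ j i))))

∑∑-δ-antidiagonal : ∀ n (c : ℕ → ℕ → ℤ) →
  ∑[ i < suc n ] ∑[ j < suc n ] (c i j * δ (i ℕ.+ j) n) ≡ ∑[ i < suc n ] c i (n ℕ.∸ i)
∑∑-δ-antidiagonal n c = ∑-cong (suc n) inner
  where
  inner : ∀ i → i ℕ.< suc n → ∑[ j < suc n ] (c i j * δ (i ℕ.+ j) n) ≡ c i (n ℕ.∸ i)
  inner i (s≤s i≤n) = trans (∑-cong (suc n) (λ j _ → cong (c i j *_) (shift {j}))) (∑-δ (suc n) (c i) (s≤s (ℕP.m∸n≤m n i)))
    where
    shift : ∀ {j} → δ (i ℕ.+ j) n ≡ δ j (n ℕ.∸ i)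
    shift {j} = trans (cong (δ (i ℕ.+ j)) (sym (ℕP.m+[n∸m]≡n i≤n))) (δ-+ˡ i j (n ℕ.∸ i))

∑∑-δ-corner : ∀ n (c : ℕ → ℕ → ℤ) → ∑[ i < suc n ] ∑[ j < suc n ] (c i j * δ (i ℕ.+ j) (n ℕ.+ n)) ≡ c n n
∑∑-δ-corner n c = trans (∑-cong (suc n) row) (∑-δ (suc n) (λ i → c i n) ℕP.≤-refl)
  where
  row : ∀ i → i ℕ.< suc n → ∑[ j < suc n ] (c i j * δ (i ℕ.+ j) (n ℕ.+ n)) ≡ c i n * δ i n
  row i (s≤s i≤n) = trans (∑-cong (suc n) split) (∑-δ (suc n) (λ j → c i j * δ i n) ℕP.≤-refl)
    where
    split : ∀ j → j ℕ.< suc n → c i j * δ (i ℕ.+ j) (n ℕ.+ n) ≡ c i j * δ i n * δ j n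
    split j (s≤s j≤n) = trans (cong (c i j *_) (δ-+-+ i≤n j≤n)) (sym (ℤP.*-assoc (c i j) (δ i n) (δ j n)))

∑ℕ-cong : ∀ {f g} n → (∀ i → i ℕ.< n → f i ≡ g i) → ∑ℕ n f ≡ ∑ℕ n g
∑ℕ-cong zero    eq = refl
∑ℕ-cong (suc n) eq = cong₂ ℕ._+_ (eq 0 (s≤s z≤n)) (∑ℕ-cong n (λ i i<n → eq (suc i) (s≤s i<n)))

∑ℕ-mono-≤ : ∀ {f g} n → (∀ i → i ℕ.< n → f i ℕ.≤ g i) → ∑ℕ n f ℕ.≤ ∑ℕ n g
∑ℕ-mono-≤ zero    le = z≤n
∑ℕ-mono-≤ (suc n) le = ℕP.+-mono-≤ (le 0 (s≤s z≤n)) (∑ℕ-mono-≤ n (λ i i<n → le (suc i) (s≤s i<n)))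

∑ℕ-+ : ∀ n f g → ∑ℕ[ i < n ] (f i ℕ.+ g i) ≡ ∑ℕ n f ℕ.+ ∑ℕ n g
∑ℕ-+ zero    f g = refl
∑ℕ-+ (suc n) f g = trans (cong (f 0 ℕ.+ g 0 ℕ.+_) (∑ℕ-+ n (f ∘ suc) (g ∘ suc)))
                         (interchange (f 0) (g 0) (∑ℕ n (f ∘ suc)) (∑ℕ n (g ∘ suc)))
  where
  interchange : ∀ a b c d → a ℕ.+ b ℕ.+ (c ℕ.+ d) ≡ a ℕ.+ c ℕ.+ (b ℕ.+ d)
  interchange = ℕ-Solver.solve-∀

∑ℕ-const : ∀ n c → ∑ℕ[ i < n ] c ≡ n ℕ.* c
∑ℕ-const zero    c = refl
∑ℕ-const (suc n) c = cong (c ℕ.+_) (∑ℕ-const n c)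

∑ℕ-zero : ∀ {f} n → (∀ i → i ℕ.< n → f i ≡ 0) → ∑ℕ n f ≡ 0
∑ℕ-zero n eq = trans (∑ℕ-cong n eq) (trans (∑ℕ-const n 0) (ℕP.*-zeroʳ n))

-- Defined through does, so that 𝟙 (suc i ≟ suc j) reduces to 𝟙 (i ≟ j).
𝟙 : ∀ {a} {A : Set a} → Dec A → ℕ
𝟙 d = if does d then 1 else 0

𝟙-yes : ∀ {a} {A : Set a} (d : Dec A) → A → 𝟙 d ≡ 1
𝟙-yes (yes _) _ = refl
𝟙-yes (no ¬a) a = ⊥-elim (¬a a)

𝟙-no : ∀ {a} {A : Set a} (d : Dec A) → ¬ A → 𝟙 d ≡ 0
𝟙-no (yes a) ¬a = ⊥-elim (¬a a)
𝟙-no (no _)  _  = refl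

𝟙-mono-≤ : ∀ {a b} {A : Set a} {B : Set b} (A? : Dec A) (B? : Dec B) → (A → B) → 𝟙 A? ℕ.≤ 𝟙 B?
𝟙-mono-≤ (no _)  _       _   = z≤n
𝟙-mono-≤ (yes a) B?      A→B = ℕP.≤-reflexive (sym (𝟙-yes B? (A→B a)))

𝟙-≤-+ : ∀ {a b c} {A : Set a} {B : Set b} {C : Set c} (A? : Dec A) (B? : Dec B) (C? : Dec C) →
        (A → B ⊎ C) → 𝟙 A? ℕ.≤ 𝟙 B? ℕ.+ 𝟙 C?
𝟙-≤-+ (no _)  B? C? _ = z≤n
𝟙-≤-+ (yes a) B? C? A→B⊎C with A→B⊎C a
... | inj₁ b = ℕP.≤-trans (ℕP.≤-reflexive (sym (𝟙-yes B? b))) (ℕP.m≤m+n (𝟙 B?) (𝟙 C?))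
... | inj₂ c = ℕP.≤-trans (ℕP.≤-reflexive (sym (𝟙-yes C? c))) (ℕP.m≤n+m (𝟙 C?) (𝟙 B?))

∑ℕ-𝟙-≡ : ∀ n r → ∑ℕ[ i < n ] 𝟙 (i ℕ.≟ r) ℕ.≤ 1
∑ℕ-𝟙-≡ zero    r       = z≤n
∑ℕ-𝟙-≡ (suc n) zero    = ℕP.≤-reflexive (cong suc (∑ℕ-zero n (λ _ _ → refl)))
∑ℕ-𝟙-≡ (suc n) (suc r) = ∑ℕ-𝟙-≡ n r

∑ℕ-𝟙-witness : ∀ {A : ℕ → Set} (A? : ∀ i → Dec (A i)) n → ∑ℕ[ i < n ] 𝟙 (A? i) ≢ 0 → ∃[ i ] (i ℕ.< n × A i)
∑ℕ-𝟙-witness A? zero    ≢0 = ⊥-elim (≢0 refl)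
∑ℕ-𝟙-witness A? (suc n) ≢0 with A? 0
... | yes a = 0 , s≤s z≤n , a
... | no _ with ∑ℕ-𝟙-witness (A? ∘ suc) n ≢0
...   | i , i<n , a = suc i , s≤s i<n , a

length-filter-∷ : ∀ {B : Set} {Q : B → Set} (Q? : ∀ b → Dec (Q b)) x xs →
  length (filter Q? (x ∷ xs)) ≡ 𝟙 (Q? x) ℕ.+ length (filter Q? xs)
length-filter-∷ Q? x xs with Q? x
... | yes _ = refl
... | no _  = refl

length-filter-applyUpTo : ∀ {B : Set} {Q : B → Set} (Q? : ∀ b → Dec (Q b)) (g : ℕ → B) n →
  length (filter Q? (applyUpTo g n)) ≡ ∑ℕ[ i < n ] 𝟙 (Q? (g i))
length-filter-applyUpTo Q? g zero    = refl
length-filter-applyUpTo Q? g (suc n) =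
  trans (length-filter-∷ Q? (g 0) _) (cong (𝟙 (Q? (g 0)) ℕ.+_) (length-filter-applyUpTo Q? (g ∘ suc) n))

length-filter-cartesianProduct : ∀ {A B : Set} {Q : A × B → Set} (Q? : ∀ ab → Dec (Q ab)) (f : ℕ → A) n (ys : List B) →
  length (filter Q? (cartesianProduct (applyUpTo f n) ys)) ≡ ∑ℕ[ i < n ] length (filter Q? (map (f i ,_) ys))
length-filter-cartesianProduct Q? f zero    ys = refl
length-filter-cartesianProduct Q? f (suc n) ys = begin
  length (filter Q? (map (f 0 ,_) ys ++ rest))                   ≡⟨ cong length (filter-++ Q? (map (f 0 ,_) ys) rest) ⟩
  length (filter Q? (map (f 0 ,_) ys) ++ filter Q? rest)         ≡⟨ length-++ (filter Q? (map (f 0 ,_) ys)) ⟩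
  length (filter Q? (map (f 0 ,_) ys)) ℕ.+ length (filter Q? rest)
    ≡⟨ cong (length (filter Q? (map (f 0 ,_) ys)) ℕ.+_) (length-filter-cartesianProduct Q? (f ∘ suc) n ys) ⟩
  ∑ℕ (suc n) (λ i → length (filter Q? (map (f i ,_) ys)))       ∎
  where
  open ≡-Reasoning
  rest = cartesianProduct (applyUpTo (f ∘ suc) n) ys

length-filter-grid : ∀ {Q : ℕ × ℕ → Set} (Q? : ∀ xy → Dec (Q xy)) n →
  length (filter Q? (cartesianProduct (upTo n) (upTo n))) ≡ ∑ℕ[ x < n ] ∑ℕ[ y < n ] 𝟙 (Q? (x , y))
length-filter-grid Q? n = trans (length-filter-cartesianProduct Q? (λ i → i) n (upTo n))
  (∑ℕ-cong n (λ x _ → trans (cong (length ∘ filter Q?) (map-upTo (x ,_) n))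
                            (length-filter-applyUpTo Q? (x ,_) n)))

sum-map-upTo : ∀ (f : ℕ → ℕ) n → sum (map f (upTo n)) ≡ ∑ℕ n f
sum-map-upTo f n = trans (cong sum (map-upTo f n)) (sum-applyUpTo f n)
  where
  sum-applyUpTo : ∀ (f : ℕ → ℕ) n → sum (applyUpTo f n) ≡ ∑ℕ n f
  sum-applyUpTo f zero    = refl
  sum-applyUpTo f (suc n) = cong (f 0 ℕ.+_) (sum-applyUpTo (f ∘ suc) n)

update : (ℕ → ℕ) → ℕ → ℕ → ℕ → ℕ
update g a c i = if i ℕ.≡ᵇ a then c else g i

update-≢ : ∀ g {a} c {i} → i ≢ a → update g a c i ≡ g i
update-≢ g {zero}  c {zero}  i≢a = ⊥-elim (i≢a refl)
update-≢ g {zero}  c {suc i} i≢a = refl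
update-≢ g {suc a} c {zero}  i≢a = refl
update-≢ g {suc a} c {suc i} i≢a = update-≢ (g ∘ suc) c (i≢a ∘ cong suc)

update-≤ : ∀ g a {c k} i → c ℕ.≤ k → g i ℕ.≤ k → update g a c i ℕ.≤ k
update-≤ g a i c≤k gi≤k with i ℕ.≡ᵇ a
... | true  = c≤k
... | false = gi≤k

∑ℕ-update : ∀ g {a} c n → a ℕ.< n → ∑ℕ n (update g a c) ℕ.+ g a ≡ ∑ℕ n g ℕ.+ c
∑ℕ-update g {zero}  c (suc n) _ = swap c (∑ℕ n (g ∘ suc)) (g 0)
  where
  swap : ∀ c s g₀ → c ℕ.+ s ℕ.+ g₀ ≡ g₀ ℕ.+ s ℕ.+ c
  swap = ℕ-Solver.solve-∀
∑ℕ-update g {suc a} c (suc n) (s≤s a<n) =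
  trans (ℕP.+-assoc (g 0) _ _) (trans (cong (g 0 ℕ.+_) (∑ℕ-update (g ∘ suc) c n a<n)) (sym (ℕP.+-assoc (g 0) _ _)))

module _ (f : ℕ → ℕ) (n : ℕ) {a b : ℕ} (a<n : a ℕ.< n) (b<n : b ℕ.< n) (a≢b : a ≢ b) where

  ∑ℕ-≤2-twoPoints : (∀ i → i ℕ.< n → f i ℕ.≤ 2) → ∑ℕ n f ℕ.+ 4 ℕ.≤ n ℕ.* 2 ℕ.+ (f a ℕ.+ f b)
  ∑ℕ-≤2-twoPoints f≤2 = begin
    ∑ℕ n f ℕ.+ 4                    ≡⟨ shuffle₁ (∑ℕ n f) ⟩
    (∑ℕ n f ℕ.+ 2) ℕ.+ 2            ≡⟨ cong (ℕ._+ 2) (∑ℕ-update f 2 n a<n) ⟨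
    (∑ℕ n f′ ℕ.+ f a) ℕ.+ 2         ≡⟨ shuffle₂ (∑ℕ n f′) (f a) ⟩
    (∑ℕ n f′ ℕ.+ 2) ℕ.+ f a         ≡⟨ cong (ℕ._+ f a) (∑ℕ-update f′ 2 n b<n) ⟨
    (∑ℕ n f″ ℕ.+ f′ b) ℕ.+ f a      ≡⟨ cong (λ z → (∑ℕ n f″ ℕ.+ z) ℕ.+ f a) (update-≢ f 2 (a≢b ∘ sym)) ⟩
    (∑ℕ n f″ ℕ.+ f b) ℕ.+ f a       ≡⟨ shuffle₃ (∑ℕ n f″) (f b) (f a) ⟩
    ∑ℕ n f″ ℕ.+ (f a ℕ.+ f b)       ≤⟨ ℕP.+-monoˡ-≤ (f a ℕ.+ f b) f″≤ ⟩
    n ℕ.* 2 ℕ.+ (f a ℕ.+ f b)       ∎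
    where
    open ℕP.≤-Reasoning
    f′ = update f a 2
    f″ = update f′ b 2
    f″≤ : ∑ℕ n f″ ℕ.≤ n ℕ.* 2
    f″≤ = ℕP.≤-trans (∑ℕ-mono-≤ n (λ i i<n → update-≤ f′ b i ℕP.≤-refl (update-≤ f a i ℕP.≤-refl (f≤2 i i<n))))
                     (ℕP.≤-reflexive (∑ℕ-const n 2))
    shuffle₁ : ∀ s → s ℕ.+ 4 ≡ (s ℕ.+ 2) ℕ.+ 2
    shuffle₁ = ℕ-Solver.solve-∀
    shuffle₂ : ∀ s x → (s ℕ.+ x) ℕ.+ 2 ≡ (s ℕ.+ 2) ℕ.+ x
    shuffle₂ = ℕ-Solver.solve-∀
    shuffle₃ : ∀ s x y → (s ℕ.+ x) ℕ.+ y ≡ s ℕ.+ (y ℕ.+ x)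
    shuffle₃ = ℕ-Solver.solve-∀

  twoPoints-≤-∑ℕ : f a ℕ.+ f b ℕ.≤ ∑ℕ n f
  twoPoints-≤-∑ℕ = begin
    f a ℕ.+ f b                     ≤⟨ ℕP.m≤n+m (f a ℕ.+ f b) (∑ℕ n f″) ⟩
    ∑ℕ n f″ ℕ.+ (f a ℕ.+ f b)       ≡⟨ shuffle (∑ℕ n f″) (f b) (f a) ⟨
    (∑ℕ n f″ ℕ.+ f b) ℕ.+ f a       ≡⟨ cong (λ z → (∑ℕ n f″ ℕ.+ z) ℕ.+ f a) (update-≢ f 0 (a≢b ∘ sym)) ⟨
    (∑ℕ n f″ ℕ.+ f′ b) ℕ.+ f a      ≡⟨ cong (ℕ._+ f a) (∑ℕ-update f′ 0 n b<n) ⟩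
    (∑ℕ n f′ ℕ.+ 0) ℕ.+ f a         ≡⟨ cong (ℕ._+ f a) (ℕP.+-identityʳ _) ⟩
    ∑ℕ n f′ ℕ.+ f a                 ≡⟨ ∑ℕ-update f 0 n a<n ⟩
    ∑ℕ n f ℕ.+ 0                    ≡⟨ ℕP.+-identityʳ _ ⟩
    ∑ℕ n f                          ∎
    where
    open ℕP.≤-Reasoning
    f′ = update f a 0
    f″ = update f′ b 0
    shuffle : ∀ s x y → (s ℕ.+ x) ℕ.+ y ≡ s ℕ.+ (y ℕ.+ x)
    shuffle = ℕ-Solver.solve-∀

^-distribʳ-* : ∀ a b n → (a * b) ^ n ≡ a ^ n * b ^ n
^-distribʳ-* a b zero    = refl
^-distribʳ-* a b (suc n) = trans (cong ((a * b) *_) (^-distribʳ-* a b n)) (interchange a b (a ^ n) (b ^ n))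
  where
  interchange : ∀ a b c d → a * b * (c * d) ≡ a * c * (b * d)
  interchange = solve-∀

-1^n*-1^n≡1 : ∀ n → -1ℤ ^ n * -1ℤ ^ n ≡ 1ℤ
-1^n*-1^n≡1 n = trans (sym (^-distribʳ-* -1ℤ -1ℤ n)) (ℤP.^-zeroˡ n)

-a^n≡-1^n*a^n : ∀ a n → (- a) ^ n ≡ -1ℤ ^ n * a ^ n
-a^n≡-1^n*a^n a n = trans (cong (_^ n) (sym (ℤP.-1*i≡-i a))) (^-distribʳ-* -1ℤ a n)

[a*a]^n≡a^[n+n] : ∀ a n → (a * a) ^ n ≡ a ^ (n ℕ.+ n)
[a*a]^n≡a^[n+n] a n = trans (^-distribʳ-* a a n) (sym (ℤP.^-distribˡ-+-* a n n))

0^n≡0 : ∀ {n} → 1 ℕ.≤ n → 0ℤ ^ n ≡ 0ℤ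
0^n≡0 {suc n} _ = ℤP.*-zeroˡ (0ℤ ^ n)

pos-^ : ∀ a n → + (a ℕ.^ n) ≡ (+ a) ^ n
pos-^ a zero    = refl
pos-^ a (suc n) = trans (ℤP.pos-* a (a ℕ.^ n)) (cong (+ a *_) (pos-^ a n))

pos-∸ : ∀ {m n} → n ℕ.≤ m → + (m ℕ.∸ n) ≡ + m - + n
pos-∸ {m} {n} n≤m = sym (trans (ℤP.[+m]-[+n]≡m⊖n m n) (ℤP.⊖-≥ n≤m))

odd≢even : ∀ a b → suc (a ℕ.+ a) ≢ b ℕ.+ b
odd≢even a       zero    ()
odd≢even zero    (suc b) eq rewrite ℕP.+-suc b b = ℕP.1+n≢0 (sym (ℕP.suc-injective eq))
odd≢even (suc a) (suc b) eq rewrite ℕP.+-suc a a | ℕP.+-suc b b =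
  odd≢even a b (ℕP.suc-injective (ℕP.suc-injective eq))

C-absorb : ∀ n k → suc k ℕ.* (suc n C suc k) ≡ suc n ℕ.* (n C k)
C-absorb zero    zero    = refl
C-absorb zero    (suc k) = begin
  suc (suc k) ℕ.* (1 C suc (suc k)) ≡⟨ cong (suc (suc k) ℕ.*_) (k>n⇒nCk≡0 {1} {suc (suc k)} (s≤s (s≤s z≤n))) ⟩
  suc (suc k) ℕ.* 0                 ≡⟨ ℕP.*-zeroʳ (suc (suc k)) ⟩
  0                                 ≡⟨ cong (1 ℕ.*_) (k>n⇒nCk≡0 {0} {suc k} (s≤s z≤n)) ⟨
  1 ℕ.* (0 C suc k)                 ∎
  where open ≡-Reasoning
C-absorb (suc n) zero    =
  trans (ℕP.*-identityˡ (suc (suc n) C 1)) (trans (nC1≡n (suc (suc n))) (sym (ℕP.*-identityʳ (suc (suc n)))))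
C-absorb (suc n) (suc k) = begin
  suc (suc k) ℕ.* (suc (suc n) C suc (suc k))
    ≡⟨ cong (suc (suc k) ℕ.*_) (nCk+nC[k+1]≡[n+1]C[k+1] (suc n) (suc k)) ⟨
  suc (suc k) ℕ.* (x ℕ.+ y)
    ≡⟨ distribute x y k ⟩
  x ℕ.+ (suc k ℕ.* x ℕ.+ suc (suc k) ℕ.* y)
    ≡⟨ cong₂ (λ a b → x ℕ.+ (a ℕ.+ b)) (C-absorb n k) (C-absorb n (suc k)) ⟩
  x ℕ.+ (suc n ℕ.* (n C k) ℕ.+ suc n ℕ.* (n C suc k))
    ≡⟨ cong (x ℕ.+_) (ℕP.*-distribˡ-+ (suc n) (n C k) (n C suc k)) ⟨
  x ℕ.+ suc n ℕ.* ((n C k) ℕ.+ (n C suc k))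
    ≡⟨ cong (λ z → x ℕ.+ suc n ℕ.* z) (nCk+nC[k+1]≡[n+1]C[k+1] n k) ⟩
  suc (suc n) ℕ.* x ∎
  where
  open ≡-Reasoning
  x = suc n C suc k
  y = suc n C suc (suc k)
  distribute : ∀ x y k → suc (suc k) ℕ.* (x ℕ.+ y) ≡ x ℕ.+ (suc k ℕ.* x ℕ.+ suc (suc k) ℕ.* y)
  distribute = ℕ-Solver.solve-∀

[1+k]Ck≡1+k : ∀ k → suc k C k ≡ suc k
[1+k]Ck≡1+k k = begin
  suc k C k           ≡⟨ nCk≡nC[n∸k] (ℕP.n≤1+n k) ⟩
  suc k C (suc k ℕ.∸ k) ≡⟨ cong (suc k C_) (ℕP.m+n∸n≡m 1 k) ⟩
  suc k C 1           ≡⟨ nC1≡n (suc k) ⟩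
  suc k               ∎
  where open ≡-Reasoning

^′≡^ : ∀ x n → x ^′ n ≡ x ^ n
^′≡^ x zero    = refl
^′≡^ x (suc n) = cong (x *_) (^′≡^ x n)

×′≡* : ∀ n x → n ×′ x ≡ + n * x
×′≡* zero    x = sym (ℤP.*-zeroˡ x)
×′≡* (suc n) x = trans (cong (_+_ x) (×′≡* n x)) (sym (ℤP.suc-* (+ n) x))

sumᶠ-toℕ : ∀ n (f : ℕ → ℤ) → sumᶠ {n} (f ∘ toℕ) ≡ ∑ n f
sumᶠ-toℕ zero    f = refl
sumᶠ-toℕ (suc n) f = cong (_+_ (f 0)) (sumᶠ-toℕ n (f ∘ suc))

binomial : ∀ x y n → (x + y) ^ n ≡ ∑[ k < suc n ] (+ (n C k) * (x ^ k * y ^ (n ℕ.∸ k)))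
binomial x y n = begin
  (x + y) ^ n                                              ≡⟨ ^′≡^ (x + y) n ⟨
  (x + y) ^′ n                                             ≡⟨ Binomial.theorem n x y ⟩
  Binomial.binomialExpansion x y n                         ≡⟨ sumᶠ-toℕ (suc n) term′ ⟩
  ∑[ k < suc n ] term′ k                                   ≡⟨ ∑-cong (suc n) (λ k _ → term′≡term k) ⟩
  ∑[ k < suc n ] (+ (n C k) * (x ^ k * y ^ (n ℕ.∸ k)))     ∎
  where
  open ≡-Reasoning
  term′ : ℕ → ℤ
  term′ k = (n C k) ×′ (x ^′ k * y ^′ (n ℕ.∸ k))
  term′≡term : ∀ k → term′ k ≡ + (n C k) * (x ^ k * y ^ (n ℕ.∸ k))
  term′≡term k = trans (cong₂ (λ a b → (n C k) ×′ (a * b)) (^′≡^ x k) (^′≡^ y (n ℕ.∸ k)))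
                       (×′≡* (n C k) (x ^ k * y ^ (n ℕ.∸ k)))

binomial-+1 : ∀ x n → (x + 1ℤ) ^ n ≡ ∑[ k < suc n ] (+ (n C k) * x ^ k)
binomial-+1 x n = trans (binomial x 1ℤ n) (∑-cong (suc n) (λ k _ → cong (+ (n C k) *_) (drop-1^ k)))
  where
  drop-1^ : ∀ k → x ^ k * 1ℤ ^ (n ℕ.∸ k) ≡ x ^ k
  drop-1^ k = trans (cong (x ^ k *_) (ℤP.^-zeroˡ (n ℕ.∸ k))) (ℤP.*-identityʳ (x ^ k))

[c*y+1]^n : ∀ c y n → (c * y + 1ℤ) ^ n ≡ ∑[ k < suc n ] (+ (n C k) * c ^ k * y ^ k)
[c*y+1]^n c y n = trans (binomial-+1 (c * y) n) (∑-cong (suc n) (λ k _ → trans (cong (+ (n C k) *_) (^-distribʳ-* c y k))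
                                                                                  (sym (ℤP.*-assoc (+ (n C k)) (c ^ k) (y ^ k)))))

[x+1]^[1+k]-x^[1+k] : ∀ x k → (x + 1ℤ) ^ suc k - x ^ suc k ≡ ∑[ j < suc k ] (+ (suc k C j) * x ^ j)
[x+1]^[1+k]-x^[1+k] x k = begin
  (x + 1ℤ) ^ suc k - x ^ suc k                               ≡⟨ cong (_- x ^ suc k) (binomial-+1 x (suc k)) ⟩
  ∑ (suc (suc k)) t - x ^ suc k                              ≡⟨ cong (_- x ^ suc k) (∑-last (suc k) t) ⟩
  ∑ (suc k) t + + (suc k C suc k) * x ^ suc k - x ^ suc k
    ≡⟨ cong (λ c → ∑ (suc k) t + + c * x ^ suc k - x ^ suc k) (nCn≡1 (suc k)) ⟩
  ∑ (suc k) t + 1ℤ * x ^ suc k - x ^ suc k                   ≡⟨ cancel (∑ (suc k) t) (x ^ suc k) ⟩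
  ∑ (suc k) t                                                ∎
  where
  open ≡-Reasoning
  t : ℕ → ℤ
  t j = + (suc k C j) * x ^ j
  cancel : ∀ a b → a + 1ℤ * b - b ≡ a
  cancel = solve-∀

module Modulo (p : ℕ) where

  infix 4 _≈_
  record _≈_ (a b : ℤ) : Set where
    constructor mk
    field
      quotient : ℤ
      a-b≡q*p  : a - b ≡ quotient * + p

  ≈-refl : ∀ {a} → a ≈ a
  ≈-refl {a} = mk 0ℤ (trans (ℤP.+-inverseʳ a) (sym (ℤP.*-zeroˡ (+ p))))

  ≡⇒≈ : ∀ {a b} → a ≡ b → a ≈ b
  ≡⇒≈ refl = ≈-refl

  ≈-sym : ∀ {a b} → a ≈ b → b ≈ a
  ≈-sym {a} {b} (mk k eq) = mk (- k) (trans (flip a b) (trans (cong -_ eq) (ℤP.neg-distribˡ-* k (+ p))))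
    where
    flip : ∀ a b → b - a ≡ - (a - b)
    flip = solve-∀

  ≈-trans : ∀ {a b c} → a ≈ b → b ≈ c → a ≈ c
  ≈-trans {a} {b} {c} (mk k eq) (mk l eq′) =
    mk (k + l) (trans (split a b c) (trans (cong₂ _+_ eq eq′) (sym (ℤP.*-distribʳ-+ (+ p) k l))))
    where
    split : ∀ a b c → a - c ≡ (a - b) + (b - c)
    split = solve-∀

  ≈-setoid : Setoid _ _
  ≈-setoid = record
    { Carrier       = ℤ
    ; _≈_           = _≈_
    ; isEquivalence = record { refl = ≈-refl ; sym = ≈-sym ; trans = ≈-trans }
    }

  module ≈-Reasoning = Relation.Binary.Reasoning.Setoid ≈-setoid

  ≈-+ : ∀ {a b c d} → a ≈ b → c ≈ d → a + c ≈ b + d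
  ≈-+ {a} {b} {c} {d} (mk k eq) (mk l eq′) =
    mk (k + l) (trans (regroup a b c d) (trans (cong₂ _+_ eq eq′) (sym (ℤP.*-distribʳ-+ (+ p) k l))))
    where
    regroup : ∀ a b c d → a + c - (b + d) ≡ (a - b) + (c - d)
    regroup = solve-∀

  ≈-neg : ∀ {a b} → a ≈ b → - a ≈ - b
  ≈-neg {a} {b} (mk k eq) = mk (- k) (trans (regroup a b) (trans (cong -_ eq) (ℤP.neg-distribˡ-* k (+ p))))
    where
    regroup : ∀ a b → - a - - b ≡ - (a - b)
    regroup = solve-∀

  ≈-- : ∀ {a b c d} → a ≈ b → c ≈ d → a - c ≈ b - d
  ≈-- a≈b c≈d = ≈-+ a≈b (≈-neg c≈d)

  ≈-*ˡ : ∀ c {a b} → a ≈ b → c * a ≈ c * b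
  ≈-*ˡ c {a} {b} (mk k eq) = mk (c * k) (trans (factor c a b) (trans (cong (c *_) eq) (sym (ℤP.*-assoc c k (+ p)))))
    where
    factor : ∀ c a b → c * a - c * b ≡ c * (a - b)
    factor = solve-∀

  ≈-* : ∀ {a b c d} → a ≈ b → c ≈ d → a * c ≈ b * d
  ≈-* {a} {b} {c} {d} a≈b c≈d =
    ≈-trans (≈-*ˡ a c≈d) (subst₂ _≈_ (ℤP.*-comm d a) (ℤP.*-comm d b) (≈-*ˡ d a≈b))

  ≈-^ : ∀ {a b} n → a ≈ b → a ^ n ≈ b ^ n
  ≈-^ zero    a≈b = ≈-refl
  ≈-^ (suc n) a≈b = ≈-* a≈b (≈-^ n a≈b)

  ≈-∑ : ∀ {f g} n → (∀ i → i ℕ.< n → f i ≈ g i) → ∑ n f ≈ ∑ n g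
  ≈-∑ zero    f≈g = ≈-refl
  ≈-∑ (suc n) f≈g = ≈-+ (f≈g 0 (s≤s z≤n)) (≈-∑ n (λ i i<n → f≈g (suc i) (s≤s i<n)))

  p≈0 : + p ≈ 0ℤ
  p≈0 = mk 1ℤ (trans (ℤP.+-identityʳ (+ p)) (sym (ℤP.*-identityˡ (+ p))))

  ≈0⇒*≈0 : ∀ {a} b → a ≈ 0ℤ → a * b ≈ 0ℤ
  ≈0⇒*≈0 b a≈0 = ≈-trans (≈-* a≈0 (≈-refl {b})) (≡⇒≈ (ℤP.*-zeroˡ b))

  ≈0⇒^≈0 : ∀ {a} n → 1 ℕ.≤ n → a ≈ 0ℤ → a ^ n ≈ 0ℤ
  ≈0⇒^≈0 (suc n) _ a≈0 = ≈0⇒*≈0 _ a≈0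

  a-b≈0⇒a≈b : ∀ {a b} → a - b ≈ 0ℤ → a ≈ b
  a-b≈0⇒a≈b {a} {b} (mk k eq) = mk k (trans (sym (ℤP.+-identityʳ (a - b))) eq)

  a≈b⇒a-b≈0 : ∀ {a b} → a ≈ b → a - b ≈ 0ℤ
  a≈b⇒a-b≈0 {a} {b} (mk k eq) = mk k (trans (ℤP.+-identityʳ (a - b)) eq)

  ∣∣⇒≈0 : ∀ a → p ℕD.∣ ∣ a ∣ → a ≈ 0ℤ
  ∣∣⇒≈0 (+ n)    (divides q eq) = mk (+ q) (trans (ℤP.+-identityʳ (+ n)) (trans (cong +_ eq) (ℤP.pos-* q p)))
  ∣∣⇒≈0 -[1+ n ] (divides q eq) = mk (- + q) (trans (ℤP.+-identityʳ -[1+ n ])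
    (trans (cong (λ z → - + z) eq) (trans (cong -_ (ℤP.pos-* q p)) (ℤP.neg-distribˡ-* (+ q) (+ p)))))

  ≈0⇒∣∣ : ∀ a → a ≈ 0ℤ → p ℕD.∣ ∣ a ∣
  ≈0⇒∣∣ a (mk k eq) = divides ∣ k ∣ (trans (cong ∣_∣ (trans (sym (ℤP.+-identityʳ a)) eq)) (ℤP.abs-* k (+ p)))

  ≈0? : ∀ a → Dec (a ≈ 0ℤ)
  ≈0? a with p ℕD.∣? ∣ a ∣
  ... | yes p∣a = yes (∣∣⇒≈0 a p∣a)
  ... | no  p∤a = no (p∤a ∘ ≈0⇒∣∣ a)

  euclid : Prime p → ∀ a b → a * b ≈ 0ℤ → a ≈ 0ℤ ⊎ b ≈ 0ℤ
  euclid p-prime a b ab≈0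
    with euclidsLemma ∣ a ∣ ∣ b ∣ p-prime (subst (p ℕD.∣_) (ℤP.abs-* a b) (≈0⇒∣∣ (a * b) ab≈0))
  ... | inj₁ p∣a = inj₁ (∣∣⇒≈0 a p∣a)
  ... | inj₂ p∣b = inj₂ (∣∣⇒≈0 b p∣b)

  ^-inverse : ∀ {e e′} → e * e′ ≈ 1ℤ → ∀ k → e ^ k * e′ ^ k ≈ 1ℤ
  ^-inverse {e} {e′} ee′≈1 k =
    ≈-trans (≡⇒≈ (sym (^-distribʳ-* e e′ k))) (≈-trans (≈-^ k ee′≈1) (≡⇒≈ (ℤP.^-zeroˡ k)))

  ^-reciprocal : ∀ {e e′ ε} n → e * e′ ≈ 1ℤ → ε * ε ≡ 1ℤ → e ^ n ≈ ε → e′ ^ n ≈ ε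
  ^-reciprocal {e} {e′} {ε} n ee′≈1 εε≡1 e^n≈ε = begin
    e′ ^ n                  ≡⟨ ℤP.*-identityˡ (e′ ^ n) ⟨
    1ℤ * e′ ^ n             ≡⟨ cong (_* e′ ^ n) εε≡1 ⟨
    ε * ε * e′ ^ n          ≈⟨ ≈-* (≈-*ˡ ε (≈-sym e^n≈ε)) (≈-refl {e′ ^ n}) ⟩
    ε * e ^ n * e′ ^ n      ≡⟨ ℤP.*-assoc ε (e ^ n) (e′ ^ n) ⟩
    ε * (e ^ n * e′ ^ n)    ≈⟨ ≈-*ˡ ε (^-inverse ee′≈1 n) ⟩
    ε * 1ℤ                  ≡⟨ ℤP.*-identityʳ ε ⟩
    ε                       ∎
    where open ≈-Reasoning

  module _ .{{_ : NonZero p}} where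

    %⇒≈ : ∀ a b → a ℕ.% p ≡ b ℕ.% p → + a ≈ + b
    %⇒≈ a b eq = mk (+ (a ℕ./ p) - + (b ℕ./ p)) (begin
      + a - + b
        ≡⟨ cong₂ _-_ (divMod a) (divMod b) ⟩
      (+ (a ℕ.% p) + + (a ℕ./ p) * + p) - (+ (b ℕ.% p) + + (b ℕ./ p) * + p)
        ≡⟨ cong (λ r → (+ (a ℕ.% p) + + (a ℕ./ p) * + p) - (+ r + + (b ℕ./ p) * + p)) (sym eq) ⟩
      (+ (a ℕ.% p) + + (a ℕ./ p) * + p) - (+ (a ℕ.% p) + + (b ℕ./ p) * + p)
        ≡⟨ cancel (+ (a ℕ.% p)) (+ (a ℕ./ p)) (+ (b ℕ./ p)) (+ p) ⟩
      (+ (a ℕ./ p) - + (b ℕ./ p)) * + p ∎)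
      where
      open ≡-Reasoning
      divMod : ∀ a → + a ≡ + (a ℕ.% p) + + (a ℕ./ p) * + p
      divMod a = trans (cong +_ (ℕM.m≡m%n+[m/n]*n a p))
                       (trans (ℤP.pos-+ (a ℕ.% p) _) (cong (_+_ (+ (a ℕ.% p))) (ℤP.pos-* (a ℕ./ p) p)))
      cancel : ∀ r x y q → (r + x * q) - (r + y * q) ≡ (x - y) * q
      cancel = solve-∀

    ≈⇒% : ∀ a b → + a ≈ + b → a ℕ.% p ≡ b ℕ.% p
    ≈⇒% a b (mk (+ k) eq) = trans (cong (ℕ._% p) a≡b+kp) (ℕM.[m+kn]%n≡m%n b k p)
      where
      a≡b+kp : a ≡ b ℕ.+ k ℕ.* p
      a≡b+kp = ℤP.+-injective (trans (regroup (+ a) (+ b))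
        (trans (cong (_+_ (+ b)) (trans eq (sym (ℤP.pos-* k p)))) (sym (ℤP.pos-+ b (k ℕ.* p)))))
        where
        regroup : ∀ a b → a ≡ b + (a - b)
        regroup = solve-∀
    ≈⇒% a b (mk -[1+ k ] eq) = sym (trans (cong (ℕ._% p) b≡a+kp) (ℕM.[m+kn]%n≡m%n a (suc k) p))
      where
      b≡a+kp : b ≡ a ℕ.+ suc k ℕ.* p
      b≡a+kp = ℤP.+-injective (trans (regroup (+ a) (+ b))
        (trans (cong (_+_ (+ a)) (trans (cong -_ eq)
                                        (trans (ℤP.neg-distribˡ-* -[1+ k ] (+ p)) (sym (ℤP.pos-* (suc k) p)))))
               (sym (ℤP.pos-+ a (suc k ℕ.* p)))))
        where
        regroup : ∀ a b → b ≡ a + - (a - b)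
        regroup = solve-∀

    residue-injective : ∀ {a b} → a ℕ.< p → b ℕ.< p → + a ≈ + b → a ≡ b
    residue-injective {a} {b} a<p b<p a≈b =
      trans (sym (ℕM.m<n⇒m%n≡m a<p)) (trans (≈⇒% a b a≈b) (ℕM.m<n⇒m%n≡m b<p))

    ≈-window-≥ : ∀ {a b} → b ℕ.≤ a → + a ≈ + b → a ℕ.< b ℕ.+ p → a ≡ b
    ≈-window-≥ {a} {b} b≤a a≈b a<b+p = ℕP.≤-antisym (ℕP.m∸n≡0⇒m≤n a∸b≡0) b≤a
      where
      a∸b≡0 : a ℕ.∸ b ≡ 0
      a∸b≡0 = residue-injective (ℕP.m<n+o⇒m∸n<o a b a<b+p) (ℕ.>-nonZero⁻¹ p)
                (≈-trans (≡⇒≈ (pos-∸ b≤a)) (a≈b⇒a-b≈0 a≈b))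

    ≈-window : ∀ {a b} → + a ≈ + b → a ℕ.< b ℕ.+ p → b ℕ.< a ℕ.+ p → a ≡ b
    ≈-window {a} {b} a≈b a<b+p b<a+p with ℕP.≤-total a b
    ... | inj₁ a≤b = sym (≈-window-≥ a≤b (≈-sym a≈b) b<a+p)
    ... | inj₂ b≤a = ≈-window-≥ b≤a a≈b a<b+p

module OddPrime (m : ℕ) (1≤m : 1 ℕ.≤ m) (p-prime : Prime (suc (m ℕ.+ m))) where

  p : ℕ
  p = suc (m ℕ.+ m)

  open Modulo p public

  1≤2m : 1 ℕ.≤ m ℕ.+ m
  1≤2m = ℕP.≤-trans 1≤m (ℕP.m≤m+n m m)

  m<2m : m ℕ.< m ℕ.+ m
  m<2m = subst (ℕ._< m ℕ.+ m) (ℕP.+-identityʳ m) (ℕP.+-monoʳ-< m 1≤m)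

  2m≈-1 : + (m ℕ.+ m) ≈ -1ℤ
  2m≈-1 = mk 1ℤ (trans (ℤP.+-comm (+ (m ℕ.+ m)) 1ℤ) (sym (ℤP.*-identityˡ (+ p))))

  nonzero-residue : ∀ {a} → 0 ℕ.< a → a ℕ.< p → ¬ (+ a ≈ 0ℤ)
  nonzero-residue 0<a a<p a≈0 = ℕP.<⇒≢ 0<a (sym (residue-injective a<p (s≤s z≤n) a≈0))

  ≈0-cancelˡ : ∀ {a b} → ¬ (a ≈ 0ℤ) → a * b ≈ 0ℤ → b ≈ 0ℤ
  ≈0-cancelˡ {a} {b} a≉0 ab≈0 with euclid p-prime a b ab≈0
  ... | inj₁ a≈0 = ⊥-elim (a≉0 a≈0)
  ... | inj₂ b≈0 = b≈0

  pC[1+k]≈0 : ∀ k → suc k ℕ.< p → + (p C suc k) ≈ 0ℤ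
  pC[1+k]≈0 k 1+k<p = ≈0-cancelˡ (nonzero-residue (s≤s z≤n) 1+k<p) (≈-trans (≡⇒≈ absorb) (≈0⇒*≈0 _ p≈0))
    where
    absorb : + suc k * + (p C suc k) ≡ + p * + ((m ℕ.+ m) C k)
    absorb = trans (sym (ℤP.pos-* (suc k) _)) (trans (cong +_ (C-absorb (m ℕ.+ m) k)) (ℤP.pos-* p _))

  freshman's-dream : ∀ x → (x + 1ℤ) ^ p ≈ x ^ p + 1ℤ
  freshman's-dream x = begin
    (x + 1ℤ) ^ p                           ≡⟨ binomial-+1 x p ⟩
    1ℤ + ∑ p (t ∘ suc)                     ≡⟨ cong (_+_ 1ℤ) (∑-last (m ℕ.+ m) (t ∘ suc)) ⟩
    1ℤ + (∑ (m ℕ.+ m) (t ∘ suc) + t p)     ≈⟨ ≈-+ (≈-refl {1ℤ}) (≈-+ middle≈0 (≡⇒≈ t[p]≡x^p)) ⟩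
    1ℤ + (0ℤ + x ^ p)                      ≡⟨ rearrange 1ℤ (x ^ p) ⟩
    x ^ p + 1ℤ                             ∎
    where
    open ≈-Reasoning
    t : ℕ → ℤ
    t k = + (p C k) * x ^ k
    middle≈0 : ∑ (m ℕ.+ m) (t ∘ suc) ≈ 0ℤ
    middle≈0 = ≈-trans (≈-∑ (m ℕ.+ m) (λ k k<2m → ≈0⇒*≈0 (x ^ suc k) (pC[1+k]≈0 k (s≤s k<2m))))
                       (≡⇒≈ (∑-zero (m ℕ.+ m)))
    t[p]≡x^p : t p ≡ x ^ p
    t[p]≡x^p = trans (cong (λ c → + c * x ^ p) (nCn≡1 p)) (ℤP.*-identityˡ (x ^ p))
    rearrange : ∀ a b → a + (0ℤ + b) ≡ b + a
    rearrange = solve-∀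

  fermat-ℕ : ∀ n → (+ n) ^ p ≈ + n
  fermat-ℕ zero    = ≈-refl
  fermat-ℕ (suc n) = begin
    (+ suc n) ^ p    ≡⟨ cong (_^ p) (ℤP.+-comm 1ℤ (+ n)) ⟩
    (+ n + 1ℤ) ^ p   ≈⟨ freshman's-dream (+ n) ⟩
    (+ n) ^ p + 1ℤ   ≈⟨ ≈-+ (fermat-ℕ n) (≈-refl {1ℤ}) ⟩
    + n + 1ℤ         ≡⟨ ℤP.+-comm (+ n) 1ℤ ⟩
    + suc n          ∎
    where open ≈-Reasoning

  ≈-%ℕ : ∀ a → a ≈ + (a ℤM.%ℕ p)
  ≈-%ℕ a = mk (a ℤM./ℕ p) (trans (cong (_- + (a ℤM.%ℕ p)) (ℤM.a≡a%ℕn+[a/ℕn]*n a p)) (cancel (+ (a ℤM.%ℕ p)) _))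
    where
    cancel : ∀ r q → r + q - r ≡ q
    cancel = solve-∀

  fermat : ∀ a → a ^ p ≈ a
  fermat a = ≈-trans (≈-^ p (≈-%ℕ a)) (≈-trans (fermat-ℕ _) (≈-sym (≈-%ℕ a)))

  ≉0⇒^2m≈1 : ∀ {a} → ¬ (a ≈ 0ℤ) → a ^ (m ℕ.+ m) ≈ 1ℤ
  ≉0⇒^2m≈1 {a} a≉0 = a-b≈0⇒a≈b (≈0-cancelˡ a≉0 (≈-trans (≡⇒≈ (factor a (a ^ (m ℕ.+ m)))) (a≈b⇒a-b≈0 (fermat a))))
    where
    factor : ∀ a y → a * (y - 1ℤ) ≡ a * y - a
    factor = solve-∀

  powerSum : ℕ → ℤ
  powerSum k = ∑[ x < p ] ((+ x) ^ k)

  powerSum-recurrence : ∀ k → ∑[ j < suc k ] (+ (suc k C j) * powerSum j) ≈ 0ℤ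
  powerSum-recurrence k = begin
    ∑[ j < suc k ] (+ (suc k C j) * powerSum j)
      ≡⟨ ∑-cong (suc k) (λ j _ → sym (∑-*ˡ p (+ (suc k C j)) (λ x → (+ x) ^ j))) ⟩
    ∑[ j < suc k ] ∑[ x < p ] (+ (suc k C j) * (+ x) ^ j) ≡⟨ ∑-swap (suc k) p (λ j x → + (suc k C j) * (+ x) ^ j) ⟩
    ∑[ x < p ] ∑[ j < suc k ] (+ (suc k C j) * (+ x) ^ j) ≡⟨ ∑-cong p (λ x _ → difference x) ⟨
    ∑[ x < p ] (g (suc x) - g x)                          ≡⟨ ∑-telescope p g ⟩
    g p - 0ℤ ^ suc k                                      ≡⟨ cong (_-_ (g p)) (ℤP.*-zeroˡ (0ℤ ^ k)) ⟩
    g p - 0ℤ                                              ≈⟨ ≈-- (≈0⇒^≈0 (suc k) (s≤s z≤n) p≈0) (≈-refl {0ℤ}) ⟩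
    0ℤ                                                    ∎
    where
    open ≈-Reasoning
    g : ℕ → ℤ
    g y = (+ y) ^ suc k
    difference : ∀ x → g (suc x) - g x ≡ ∑[ j < suc k ] (+ (suc k C j) * (+ x) ^ j)
    difference x = trans (cong (λ y → y ^ suc k - g x) (ℤP.+-comm 1ℤ (+ x))) ([x+1]^[1+k]-x^[1+k] (+ x) k)

  powerSum-vanishes : ∀ k → k ℕ.< m ℕ.+ m → powerSum k ≈ 0ℤ
  powerSum-vanishes = <-rec (λ k → k ℕ.< m ℕ.+ m → powerSum k ≈ 0ℤ) step
    where
    step : ∀ k → (∀ {j} → j ℕ.< k → j ℕ.< m ℕ.+ m → powerSum j ≈ 0ℤ) → k ℕ.< m ℕ.+ m → powerSum k ≈ 0ℤ
    step k ih k<2m = ≈0-cancelˡ (nonzero-residue (s≤s z≤n) (s≤s k<2m)) (begin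
      + suc k * powerSum k ≡⟨ cong (λ c → + c * powerSum k) ([1+k]Ck≡1+k k) ⟨
      t k                  ≡⟨ ℤP.+-identityˡ (t k) ⟨
      0ℤ + t k             ≈⟨ ≈-+ (≈-sym lower≈0) (≈-refl {t k}) ⟩
      ∑ k t + t k          ≡⟨ ∑-last k t ⟨
      ∑ (suc k) t          ≈⟨ powerSum-recurrence k ⟩
      0ℤ                   ∎)
      where
      open ≈-Reasoning
      t : ℕ → ℤ
      t j = + (suc k C j) * powerSum j
      lower≈0 : ∑ k t ≈ 0ℤ
      lower≈0 = ≈-trans (≈-∑ k (λ j j<k → ≈-trans (≈-*ˡ (+ (suc k C j)) (ih j<k (ℕP.<-trans j<k k<2m)))
                                                  (≡⇒≈ (ℤP.*-zeroʳ (+ (suc k C j))))))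
                        (≡⇒≈ (∑-zero k))

  powerSum-2m : powerSum (m ℕ.+ m) ≈ -1ℤ
  powerSum-2m = begin
    0ℤ ^ (m ℕ.+ m) + ∑[ x < m ℕ.+ m ] ((+ suc x) ^ (m ℕ.+ m))
      ≡⟨ cong (_+ ∑[ x < m ℕ.+ m ] ((+ suc x) ^ (m ℕ.+ m))) (0^n≡0 1≤2m) ⟩
    0ℤ + ∑[ x < m ℕ.+ m ] ((+ suc x) ^ (m ℕ.+ m))              ≡⟨ ℤP.+-identityˡ _ ⟩
    ∑[ x < m ℕ.+ m ] ((+ suc x) ^ (m ℕ.+ m))
      ≈⟨ ≈-∑ (m ℕ.+ m) (λ x x<2m → ≉0⇒^2m≈1 (nonzero-residue (s≤s z≤n) (s≤s x<2m))) ⟩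
    ∑[ x < m ℕ.+ m ] 1ℤ                                      ≡⟨ trans (∑-const (m ℕ.+ m) 1ℤ) (ℤP.*-identityʳ _) ⟩
    + (m ℕ.+ m)                                              ≈⟨ 2m≈-1 ⟩
    -1ℤ                                                      ∎
    where
    open ≈-Reasoning

  powerSum-periodic : ∀ k → 1 ℕ.≤ k → powerSum (m ℕ.+ m ℕ.+ k) ≈ powerSum k
  powerSum-periodic (suc k) _ = ≈-∑ p term
    where
    term : ∀ x → x ℕ.< p → (+ x) ^ (m ℕ.+ m ℕ.+ suc k) ≈ (+ x) ^ suc k
    term zero    _     =
      ≡⇒≈ (trans (0^n≡0 (ℕP.≤-trans (s≤s z≤n) (ℕP.m≤n+m (suc k) (m ℕ.+ m)))) (sym (0^n≡0 {suc k} (s≤s z≤n))))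
    term (suc x) 1+x<p = begin
      (+ suc x) ^ (m ℕ.+ m ℕ.+ suc k)        ≡⟨ ℤP.^-distribˡ-+-* (+ suc x) (m ℕ.+ m) (suc k) ⟩
      (+ suc x) ^ (m ℕ.+ m) * (+ suc x) ^ suc k ≈⟨ ≈-* (≉0⇒^2m≈1 (nonzero-residue (s≤s z≤n) 1+x<p)) (≈-refl {(+ suc x) ^ suc k}) ⟩
      1ℤ * (+ suc x) ^ suc k                 ≡⟨ ℤP.*-identityˡ _ ⟩
      (+ suc x) ^ suc k                      ∎
      where open ≈-Reasoning

  X : ℕ → ℤ
  X x = + x * + x

  squarePowerSum : ℕ → ℤ
  squarePowerSum j = ∑[ x < p ] (X x ^ j)

  squarePowerSum≡powerSum : ∀ j → squarePowerSum j ≡ powerSum (j ℕ.+ j)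
  squarePowerSum≡powerSum j = ∑-cong p (λ x _ → [a*a]^n≡a^[n+n] (+ x) j)

  squarePowerSum-≤m : ∀ j → j ℕ.≤ m → squarePowerSum j ≈ - δ j m
  squarePowerSum-≤m j j≤m with j ℕ.≟ m
  ... | yes refl = ≈-trans (≡⇒≈ (squarePowerSum≡powerSum m)) (≈-trans powerSum-2m (≡⇒≈ (cong -_ (sym (δ-refl m)))))
  ... | no j≢m = ≈-trans (≡⇒≈ (squarePowerSum≡powerSum j))
                   (≈-trans (powerSum-vanishes (j ℕ.+ j) (ℕP.+-mono-< j<m j<m)) (≡⇒≈ (cong -_ (sym (δ-≢ j≢m)))))
    where
    j<m = ℕP.≤∧≢⇒< j≤m j≢m

  squarePowerSum-periodic : ∀ i → 1 ℕ.≤ i → squarePowerSum (m ℕ.+ i) ≈ squarePowerSum i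
  squarePowerSum-periodic i 1≤i = begin
    squarePowerSum (m ℕ.+ i)           ≡⟨ squarePowerSum≡powerSum (m ℕ.+ i) ⟩
    powerSum (m ℕ.+ i ℕ.+ (m ℕ.+ i))   ≡⟨ cong powerSum (interchange m i) ⟩
    powerSum (m ℕ.+ m ℕ.+ (i ℕ.+ i))   ≈⟨ powerSum-periodic (i ℕ.+ i) (ℕP.≤-trans 1≤i (ℕP.m≤m+n i i)) ⟩
    powerSum (i ℕ.+ i)                 ≡⟨ squarePowerSum≡powerSum i ⟨
    squarePowerSum i                   ∎
    where
    open ≈-Reasoning
    interchange : ∀ m i → m ℕ.+ i ℕ.+ (m ℕ.+ i) ≡ m ℕ.+ m ℕ.+ (i ℕ.+ i)
    interchange = ℕ-Solver.solve-∀

  squarePowerSum-≈ : ∀ j → j ℕ.≤ m ℕ.+ m → squarePowerSum j ≈ - δ j m - δ j (m ℕ.+ m)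
  squarePowerSum-≈ j j≤2m with j ℕ.≤? m
  ... | yes j≤m = ≈-trans (squarePowerSum-≤m j j≤m) (≡⇒≈ (sym (trans (cong (λ z → - δ j m - z) δ[j,2m]≡0) (ℤP.+-identityʳ _))))
    where
    δ[j,2m]≡0 : δ j (m ℕ.+ m) ≡ 0ℤ
    δ[j,2m]≡0 = δ-≢ (ℕP.<⇒≢ (ℕP.≤-<-trans j≤m m<2m))
  ... | no j≰m = begin
    squarePowerSum j                        ≡⟨ cong squarePowerSum j≡m+i ⟩
    squarePowerSum (m ℕ.+ i)                ≈⟨ squarePowerSum-periodic i 1≤i ⟩
    squarePowerSum i                        ≈⟨ squarePowerSum-≤m i i≤m ⟩
    - δ i m                                 ≡⟨ ℤP.+-identityˡ (- δ i m) ⟨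
    - 0ℤ - δ i m                            ≡⟨ cong₂ (λ a b → - a - b) (sym δ[m+i,m]≡0) (sym (δ-+ˡ m i m)) ⟩
    - δ (m ℕ.+ i) m - δ (m ℕ.+ i) (m ℕ.+ m) ≡⟨ cong (λ z → - δ z m - δ z (m ℕ.+ m)) j≡m+i ⟨
    - δ j m - δ j (m ℕ.+ m)                 ∎
    where
    open ≈-Reasoning
    m<j = ℕP.≰⇒> j≰m
    i = j ℕ.∸ m
    j≡m+i : j ≡ m ℕ.+ i
    j≡m+i = sym (ℕP.m+[n∸m]≡n (ℕP.<⇒≤ m<j))
    1≤i : 1 ℕ.≤ i
    1≤i = ℕP.m<n⇒0<n∸m m<j
    i≤m : i ℕ.≤ m
    i≤m = ℕP.+-cancelˡ-≤ m i m (subst (ℕ._≤ m ℕ.+ m) j≡m+i j≤2m)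
    δ[m+i,m]≡0 : δ (m ℕ.+ i) m ≡ 0ℤ
    δ[m+i,m]≡0 = δ-≢ (λ eq → ℕP.<-irrefl (trans (sym eq) (sym j≡m+i)) m<j)

  *-−-− : ∀ c a b → c * (- a - b) ≡ - (c * a) - c * b
  *-−-− = solve-∀

  ∑-polynomial : ∀ (f : ℕ → ℤ) → ∑[ x < p ] ∑[ j < suc (m ℕ.+ m) ] (f j * X x ^ j) ≈ - f m - f (m ℕ.+ m)
  ∑-polynomial f = begin
    ∑[ x < p ] ∑[ j < 2m+1 ] (f j * X x ^ j)                  ≡⟨ ∑-swap p 2m+1 (λ x j → f j * X x ^ j) ⟩
    ∑[ j < 2m+1 ] ∑[ x < p ] (f j * X x ^ j)                  ≡⟨ ∑-cong 2m+1 (λ j _ → ∑-*ˡ p (f j) (λ x → X x ^ j)) ⟩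
    ∑[ j < 2m+1 ] (f j * squarePowerSum j)
      ≈⟨ ≈-∑ 2m+1 (λ j j<2m+1 → ≈-*ˡ (f j) (squarePowerSum-≈ j (ℕP.≤-pred j<2m+1))) ⟩
    ∑[ j < 2m+1 ] (f j * (- δ j m - δ j (m ℕ.+ m)))
      ≡⟨ ∑-cong 2m+1 (λ j _ → *-−-− (f j) (δ j m) (δ j (m ℕ.+ m))) ⟩
    ∑[ j < 2m+1 ] (- (f j * δ j m) - f j * δ j (m ℕ.+ m))
      ≡⟨ ∑-−-− 2m+1 (λ j → f j * δ j m) (λ j → f j * δ j (m ℕ.+ m)) ⟩
    - ∑[ j < 2m+1 ] (f j * δ j m) - ∑[ j < 2m+1 ] (f j * δ j (m ℕ.+ m))
      ≡⟨ cong₂ (λ a b → - a - b) (∑-δ 2m+1 f (s≤s (ℕP.m≤m+n m m))) (∑-δ 2m+1 f ℕP.≤-refl) ⟩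
    - f m - f (m ℕ.+ m)                                        ∎
    where
    open ≈-Reasoning
    2m+1 = suc (m ℕ.+ m)

  ∑-polynomial² : ∀ (c : ℕ → ℕ → ℤ) →
    ∑[ x < p ] ∑[ i < suc m ] ∑[ j < suc m ] (c i j * X x ^ (i ℕ.+ j)) ≈ - ∑[ i < suc m ] c i (m ℕ.∸ i) - c m m
  ∑-polynomial² c = begin
    ∑[ x < p ] ∑[ i < suc m ] ∑[ j < suc m ] (c i j * X x ^ (i ℕ.+ j))
      ≡⟨ ∑-swap p (suc m) (λ x i → ∑[ j < suc m ] (c i j * X x ^ (i ℕ.+ j))) ⟩
    ∑[ i < suc m ] ∑[ x < p ] ∑[ j < suc m ] (c i j * X x ^ (i ℕ.+ j))
      ≡⟨ ∑-cong (suc m) (λ i _ → trans (∑-swap p (suc m) (λ x j → c i j * X x ^ (i ℕ.+ j)))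
                                        (∑-cong (suc m) (λ j _ → ∑-*ˡ p (c i j) (λ x → X x ^ (i ℕ.+ j))))) ⟩
    ∑[ i < suc m ] ∑[ j < suc m ] (c i j * squarePowerSum (i ℕ.+ j))
      ≈⟨ ≈-∑ (suc m) (λ i i≤m → ≈-∑ (suc m) (λ j j≤m →
           ≈-*ˡ (c i j) (squarePowerSum-≈ (i ℕ.+ j) (ℕP.+-mono-≤ (ℕP.≤-pred i≤m) (ℕP.≤-pred j≤m))))) ⟩
    ∑[ i < suc m ] ∑[ j < suc m ] (c i j * (- δ (i ℕ.+ j) m - δ (i ℕ.+ j) (m ℕ.+ m)))
      ≡⟨ ∑-cong (suc m) (λ i _ → trans (∑-cong (suc m) (λ j _ → *-−-− (c i j) (δ (i ℕ.+ j) m) (δ (i ℕ.+ j) (m ℕ.+ m))))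
                                        (∑-−-− (suc m) (A i) (B i))) ⟩
    ∑[ i < suc m ] (- ∑ (suc m) (A i) - ∑ (suc m) (B i))
      ≡⟨ ∑-−-− (suc m) (λ i → ∑ (suc m) (A i)) (λ i → ∑ (suc m) (B i)) ⟩
    - ∑[ i < suc m ] ∑ (suc m) (A i) - ∑[ i < suc m ] ∑ (suc m) (B i)
      ≡⟨ cong₂ (λ a b → - a - b) (∑∑-δ-antidiagonal m c) (∑∑-δ-corner m c) ⟩
    - ∑[ i < suc m ] c i (m ℕ.∸ i) - c m m
      ∎
    where
    open ≈-Reasoning
    A B : ℕ → ℕ → ℤ
    A i j = c i j * δ (i ℕ.+ j) m
    B i j = c i j * δ (i ℕ.+ j) (m ℕ.+ m)

  C[2m,j]≈-1^j : ∀ j → j ℕ.≤ m ℕ.+ m → + ((m ℕ.+ m) C j) ≈ -1ℤ ^ j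
  C[2m,j]≈-1^j zero    _       = ≈-refl
  C[2m,j]≈-1^j (suc j) 1+j≤2m = begin
    + ((m ℕ.+ m) C suc j)                                ≡⟨ pascal ⟩
    + ((m ℕ.+ m) C j ℕ.+ (m ℕ.+ m) C suc j) - + ((m ℕ.+ m) C j)
      ≡⟨ cong (λ c → + c - + ((m ℕ.+ m) C j)) (nCk+nC[k+1]≡[n+1]C[k+1] (m ℕ.+ m) j) ⟩
    + (p C suc j) - + ((m ℕ.+ m) C j)
      ≈⟨ ≈-- (pC[1+k]≈0 j (s≤s 1+j≤2m)) (C[2m,j]≈-1^j j (ℕP.≤-trans (ℕP.n≤1+n j) 1+j≤2m)) ⟩
    0ℤ - -1ℤ ^ j                                         ≡⟨ negate (-1ℤ ^ j) ⟩
    -1ℤ ^ suc j                                          ∎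
    where
    open ≈-Reasoning
    pascal : + ((m ℕ.+ m) C suc j) ≡ + ((m ℕ.+ m) C j ℕ.+ (m ℕ.+ m) C suc j) - + ((m ℕ.+ m) C j)
    pascal = trans (cancel (+ ((m ℕ.+ m) C j)) _) (cong (_- + ((m ℕ.+ m) C j)) (sym (ℤP.pos-+ ((m ℕ.+ m) C j) _)))
      where
      cancel : ∀ a b → b ≡ a + b - a
      cancel = solve-∀
    negate : ∀ z → 0ℤ - z ≡ -1ℤ * z
    negate = solve-∀

  X≈0⇒≡0 : ∀ {y} → y ℕ.< p → X y ≈ 0ℤ → y ≡ 0
  X≈0⇒≡0 {y} y<p yy≈0 with euclid p-prime (+ y) (+ y) yy≈0
  ... | inj₁ y≈0 = residue-injective y<p (s≤s z≤n) y≈0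
  ... | inj₂ y≈0 = residue-injective y<p (s≤s z≤n) y≈0

  X-∸ : ∀ {x} → x ℕ.≤ p → X (p ℕ.∸ x) ≈ X x
  X-∸ {x} x≤p =
    ≈-trans (≡⇒≈ (cong (λ z → z * z) (pos-∸ x≤p))) (≈-trans (≈-* p-x≈-x p-x≈-x) (≡⇒≈ (square-neg (+ x))))
    where
    p-x≈-x : + p - + x ≈ 0ℤ - + x
    p-x≈-x = ≈-- p≈0 (≈-refl {+ x})
    square-neg : ∀ a → (0ℤ - a) * (0ℤ - a) ≡ a * a
    square-neg = solve-∀

  +≈0⇒≡⊎≡p∸ : ∀ {y r} → y ℕ.< p → r ℕ.< p → + y + + r ≈ 0ℤ → y ≡ r ⊎ y ≡ p ℕ.∸ r
  +≈0⇒≡⊎≡p∸ {y} {zero}  y<p _   y+0≈0 =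
    inj₁ (residue-injective y<p (s≤s z≤n) (≈-trans (≡⇒≈ (sym (ℤP.+-identityʳ (+ y)))) y+0≈0))
  +≈0⇒≡⊎≡p∸ {y} {suc r} y<p r<p y+r≈0 =
    inj₂ (residue-injective y<p (s≤s (ℕP.m∸n≤m (m ℕ.+ m) r)) (a-b≈0⇒a≈b (≈-trans (≡⇒≈ regroup) (≈-- y+r≈0 p≈0))))
    where
    regroup : + y - + (p ℕ.∸ suc r) ≡ (+ y + + suc r) - + p
    regroup = trans (cong (λ z → + y - z) (pos-∸ (ℕP.<⇒≤ r<p))) (rearrange (+ y) (+ p) (+ suc r))
      where
      rearrange : ∀ a b c → a - (b - c) ≡ (a + c) - b
      rearrange = solve-∀

  X≈X⇒≡⊎≡p∸ : ∀ {y r} → y ℕ.< p → r ℕ.< p → X y ≈ X r → y ≡ r ⊎ y ≡ p ℕ.∸ r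
  X≈X⇒≡⊎≡p∸ {y} {r} y<p r<p yy≈rr
    with euclid p-prime (+ y - + r) (+ y + + r) (≈-trans (≡⇒≈ (difference-of-squares (+ y) (+ r))) (a≈b⇒a-b≈0 yy≈rr))
    where
    difference-of-squares : ∀ a b → (a - b) * (a + b) ≡ a * a - b * b
    difference-of-squares = solve-∀
  ... | inj₁ y-r≈0 = inj₁ (residue-injective y<p r<p (a-b≈0⇒a≈b y-r≈0))
  ... | inj₂ y+r≈0 = +≈0⇒≡⊎≡p∸ y<p r<p y+r≈0

  module Solutions (Pr : ℕ → Set) (Pr? : ∀ y → Dec (Pr y)) (u v : ℤ)
                   (sound    : ∀ {y} → y ℕ.< p → Pr y → u * X y ≈ v)
                   (complete : ∀ {y} → y ℕ.< p → u * X y ≈ v → Pr y) where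

    count : ℕ
    count = ∑ℕ[ y < p ] 𝟙 (Pr? y)

    𝟙≈1-[uX-v]^2m : ∀ {y} → y ℕ.< p → + 𝟙 (Pr? y) ≈ 1ℤ - (u * X y - v) ^ (m ℕ.+ m)
    𝟙≈1-[uX-v]^2m {y} y<p with Pr? y
    ... | yes pr = ≈-sym (≈--  (≈-refl {1ℤ}) (≈0⇒^≈0 (m ℕ.+ m) 1≤2m (a≈b⇒a-b≈0 (sound y<p pr))))
    ... | no ¬pr = ≈-sym (≈-trans (≈-- (≈-refl {1ℤ}) (≉0⇒^2m≈1 (¬pr ∘ complete y<p ∘ a-b≈0⇒a≈b)))
                                  (≡⇒≈ (ℤP.+-inverseʳ 1ℤ)))

    coefficient : ℕ → ℤ
    coefficient j = + ((m ℕ.+ m) C j) * u ^ j * (- v) ^ (m ℕ.+ m ℕ.∸ j)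

    [uX-v]^2m-expansion : ∀ y → (u * X y - v) ^ (m ℕ.+ m) ≡ ∑[ j < suc (m ℕ.+ m) ] (coefficient j * X y ^ j)
    [uX-v]^2m-expansion y = trans (binomial (u * X y) (- v) (m ℕ.+ m)) (∑-cong (suc (m ℕ.+ m)) term)
      where
      term : ∀ j → j ℕ.< suc (m ℕ.+ m) →
             + ((m ℕ.+ m) C j) * ((u * X y) ^ j * (- v) ^ (m ℕ.+ m ℕ.∸ j)) ≡ coefficient j * X y ^ j
      term j _ = trans (cong (λ z → + ((m ℕ.+ m) C j) * (z * (- v) ^ (m ℕ.+ m ℕ.∸ j))) (^-distribʳ-* u (X y) j))
                       (rearrange (+ ((m ℕ.+ m) C j)) (u ^ j) (X y ^ j) ((- v) ^ (m ℕ.+ m ℕ.∸ j)))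
        where
        rearrange : ∀ c a x w → c * (a * x * w) ≡ c * a * w * x
        rearrange = solve-∀

    coefficient-m : coefficient m ≈ (u * v) ^ m
    coefficient-m = begin
      + ((m ℕ.+ m) C m) * u ^ m * (- v) ^ (m ℕ.+ m ℕ.∸ m)
        ≡⟨ cong (λ k → + ((m ℕ.+ m) C m) * u ^ m * (- v) ^ k) (ℕP.m+n∸m≡n m m) ⟩
      + ((m ℕ.+ m) C m) * u ^ m * (- v) ^ m
        ≈⟨ ≈-* (≈-* (C[2m,j]≈-1^j m (ℕP.m≤m+n m m)) (≈-refl {u ^ m})) (≈-refl {(- v) ^ m}) ⟩
      -1ℤ ^ m * u ^ m * (- v) ^ m                         ≡⟨ cong (λ z → -1ℤ ^ m * u ^ m * z) (-a^n≡-1^n*a^n v m) ⟩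
      -1ℤ ^ m * u ^ m * (-1ℤ ^ m * v ^ m)                 ≡⟨ rearrange (-1ℤ ^ m) (u ^ m) (v ^ m) ⟩
      (-1ℤ ^ m * -1ℤ ^ m) * (u ^ m * v ^ m)               ≡⟨ cong₂ _*_ (-1^n*-1^n≡1 m) (sym (^-distribʳ-* u v m)) ⟩
      1ℤ * (u * v) ^ m                                    ≡⟨ ℤP.*-identityˡ _ ⟩
      (u * v) ^ m                                         ∎
      where
      open ≈-Reasoning
      rearrange : ∀ s a b → s * a * (s * b) ≡ (s * s) * (a * b)
      rearrange = solve-∀

    coefficient-2m : coefficient (m ℕ.+ m) ≡ u ^ (m ℕ.+ m)
    coefficient-2m = begin
      + ((m ℕ.+ m) C (m ℕ.+ m)) * u ^ (m ℕ.+ m) * (- v) ^ (m ℕ.+ m ℕ.∸ (m ℕ.+ m))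
        ≡⟨ cong₂ (λ c k → + c * u ^ (m ℕ.+ m) * (- v) ^ k) (nCn≡1 (m ℕ.+ m)) (ℕP.n∸n≡0 (m ℕ.+ m)) ⟩
      1ℤ * u ^ (m ℕ.+ m) * 1ℤ ≡⟨ trans (ℤP.*-identityʳ _) (ℤP.*-identityˡ _) ⟩
      u ^ (m ℕ.+ m) ∎
      where open ≡-Reasoning

    count≈ : + count ≈ (u * v) ^ m + u ^ (m ℕ.+ m)
    count≈ = begin
      + count                                                  ≡⟨ ∑-pos p (λ y → 𝟙 (Pr? y)) ⟩
      ∑[ y < p ] (+ 𝟙 (Pr? y))                                 ≈⟨ ≈-∑ p (λ y y<p → 𝟙≈1-[uX-v]^2m y<p) ⟩
      ∑[ y < p ] (1ℤ - (u * X y - v) ^ (m ℕ.+ m))              ≡⟨ ∑-+ p (λ _ → 1ℤ) (λ y → - (u * X y - v) ^ (m ℕ.+ m)) ⟩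
      ∑[ y < p ] 1ℤ + ∑[ y < p ] (- (u * X y - v) ^ (m ℕ.+ m))
        ≡⟨ cong₂ _+_ (trans (∑-const p 1ℤ) (ℤP.*-identityʳ (+ p))) (∑-neg p (λ y → (u * X y - v) ^ (m ℕ.+ m))) ⟩
      + p - ∑[ y < p ] ((u * X y - v) ^ (m ℕ.+ m))             ≡⟨ cong (_-_ (+ p)) (∑-cong p (λ y _ → [uX-v]^2m-expansion y)) ⟩
      + p - ∑[ y < p ] ∑[ j < suc (m ℕ.+ m) ] (coefficient j * X y ^ j)
                                                               ≈⟨ ≈-- p≈0 (∑-polynomial coefficient) ⟩
      0ℤ - (- coefficient m - coefficient (m ℕ.+ m))           ≡⟨ negate (coefficient m) (coefficient (m ℕ.+ m)) ⟩
      coefficient m + coefficient (m ℕ.+ m)                    ≈⟨ ≈-+ coefficient-m (≡⇒≈ coefficient-2m) ⟩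
      (u * v) ^ m + u ^ (m ℕ.+ m)                              ∎
      where
      open ≈-Reasoning
      negate : ∀ a b → 0ℤ - (- a - b) ≡ a + b
      negate = solve-∀

    count≡0 : u ≈ 0ℤ → ¬ (v ≈ 0ℤ) → count ≡ 0
    count≡0 u≈0 v≉0 = ∑ℕ-zero p (λ y y<p → 𝟙-no (Pr? y) (λ pr →
      v≉0 (≈-trans (≈-sym (sound y<p pr)) (≈0⇒*≈0 (X y) u≈0))))

    1≤count : v ≈ 0ℤ → 1 ℕ.≤ count
    1≤count v≈0 = ℕP.≤-trans (ℕP.≤-reflexive (sym (𝟙-yes (Pr? 0) (complete (s≤s z≤n) u*0≈v))))
                             (ℕP.m≤m+n (𝟙 (Pr? 0)) _)
      where
      u*0≈v : u * X 0 ≈ v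
      u*0≈v = ≈-trans (≡⇒≈ (ℤP.*-zeroʳ u)) (≈-sym v≈0)

    count≤1 : ¬ (u ≈ 0ℤ) → v ≈ 0ℤ → count ℕ.≤ 1
    count≤1 u≉0 v≈0 = ℕP.≤-trans (∑ℕ-mono-≤ p (λ y y<p → 𝟙-mono-≤ (Pr? y) (y ℕ.≟ 0) (only-0 y<p))) (∑ℕ-𝟙-≡ p 0)
      where
      only-0 : ∀ {y} → y ℕ.< p → Pr y → y ≡ 0
      only-0 y<p pr = X≈0⇒≡0 y<p (≈0-cancelˡ u≉0 (≈-trans (sound y<p pr) v≈0))

    count≤2 : (u ≈ 0ℤ → ¬ (v ≈ 0ℤ)) → count ℕ.≤ 2
    count≤2 nondegenerate with ≈0? u
    ... | yes u≈0 = ℕP.≤-trans (ℕP.≤-reflexive (count≡0 u≈0 (nondegenerate u≈0))) z≤n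
    ... | no u≉0 with count ℕ.≟ 0
    ...   | yes none = ℕP.≤-trans (ℕP.≤-reflexive none) z≤n
    ...   | no some with ∑ℕ-𝟙-witness Pr? p some
    ...     | r , r<p , pr =
      ℕP.≤-trans (∑ℕ-mono-≤ p (λ y y<p → 𝟙-≤-+ (Pr? y) (y ℕ.≟ r) (y ℕ.≟ p ℕ.∸ r) (root r<p y<p)))
                 (ℕP.≤-trans (ℕP.≤-reflexive (∑ℕ-+ p (λ y → 𝟙 (y ℕ.≟ r)) (λ y → 𝟙 (y ℕ.≟ p ℕ.∸ r))))
                             (ℕP.+-mono-≤ (∑ℕ-𝟙-≡ p r) (∑ℕ-𝟙-≡ p (p ℕ.∸ r))))
      where
      root : ∀ {y} → r ℕ.< p → y ℕ.< p → Pr y → y ≡ r ⊎ y ≡ p ℕ.∸ r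
      root {y} r<p y<p pry = X≈X⇒≡⊎≡p∸ y<p r<p (a-b≈0⇒a≈b (≈0-cancelˡ u≉0
        (≈-trans (≡⇒≈ (factor u (X y) (X r))) (a≈b⇒a-b≈0 (≈-trans (sound y<p pry) (≈-sym (sound r<p pr)))))))
        where
        factor : ∀ a b c → a * (b - c) ≡ a * b - a * c
        factor = solve-∀

  X-root : ∀ {d} (sq : IsSquare p d) → X (proj₁ sq) ≈ + d
  X-root {d} (t , _ , tt≡d) = ≈-trans (≡⇒≈ (sym (ℤP.pos-* t t))) (%⇒≈ (t ℕ.* t) d tt≡d)

  euler-square : ∀ {d} → ¬ (+ d ≈ 0ℤ) → IsSquare p d → (+ d) ^ m ≈ 1ℤ
  euler-square {d} d≉0 sq@(t , _ , _) = begin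
    (+ d) ^ m          ≈⟨ ≈-^ m (≈-sym (X-root sq)) ⟩
    X t ^ m            ≡⟨ [a*a]^n≡a^[n+n] (+ t) m ⟩
    (+ t) ^ (m ℕ.+ m)  ≈⟨ ≉0⇒^2m≈1 t≉0 ⟩
    1ℤ                 ∎
    where
    open ≈-Reasoning
    t≉0 : ¬ (+ t ≈ 0ℤ)
    t≉0 t≈0 = d≉0 (≈-trans (≈-sym (X-root sq)) (≈0⇒*≈0 (+ t) t≈0))

  euler-nonsquare : ∀ {d} → ¬ IsSquare p d → (+ d) ^ m ≈ -1ℤ
  euler-nonsquare {d} nonsquare = begin
    (+ d) ^ m                ≡⟨ cancel ((+ d) ^ m) ⟩
    ((+ d) ^ m + 1ℤ) - 1ℤ    ≈⟨ ≈-- d^m+1≈0 (≈-refl {1ℤ}) ⟩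
    0ℤ - 1ℤ                  ≡⟨⟩
    -1ℤ                      ∎
    where
    open ≈-Reasoning
    IsRoot : ℕ → Set
    IsRoot y = (y ℕ.* y) ℕ.% p ≡ d ℕ.% p
    sound : ∀ {y} → y ℕ.< p → IsRoot y → 1ℤ * X y ≈ + d
    sound {y} _ root = ≈-trans (≡⇒≈ (trans (ℤP.*-identityˡ (X y)) (sym (ℤP.pos-* y y)))) (%⇒≈ (y ℕ.* y) d root)
    complete : ∀ {y} → y ℕ.< p → 1ℤ * X y ≈ + d → IsRoot y
    complete {y} _ yy≈d = ≈⇒% (y ℕ.* y) d (≈-trans (≡⇒≈ (trans (ℤP.pos-* y y) (sym (ℤP.*-identityˡ (X y))))) yy≈d)
    open Solutions IsRoot (λ y → (y ℕ.* y) ℕ.% p ℕ.≟ d ℕ.% p) 1ℤ (+ d) sound complete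
    d^m+1≈0 : (+ d) ^ m + 1ℤ ≈ 0ℤ
    d^m+1≈0 = ≈-sym (≈-trans (≡⇒≈ (cong +_ (sym no-roots))) (≈-trans count≈
      (≡⇒≈ (cong₂ _+_ (cong (_^ m) (ℤP.*-identityˡ (+ d))) (ℤP.^-zeroˡ (m ℕ.+ m))))))
      where
      no-roots : count ≡ 0
      no-roots = ∑ℕ-zero p (λ y y<p → 𝟙-no (_ ℕ.≟ _) (λ root → nonsquare (y , y<p , root)))
    cancel : ∀ a → a ≡ (a + 1ℤ) - 1ℤ
    cancel = solve-∀

  binomSquareSum : ℤ → ℤ
  binomSquareSum e = ∑[ k < suc m ] (+ (m C k) * + (m C k) * e ^ k)

  binomSum≡binomSquareSum : ∀ d → + binomSum p d ≡ binomSquareSum (+ d)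
  binomSum≡binomSquareSum d = begin
    + binomSum p d                                  ≡⟨ cong (λ n → + sum (map (term n) (upTo (suc n)))) [p∸1]/2≡m ⟩
    + sum (map (term m) (upTo (suc m)))             ≡⟨ cong +_ (sum-map-upTo (term m) (suc m)) ⟩
    + ∑ℕ (suc m) (term m)                           ≡⟨ ∑-pos (suc m) (term m) ⟩
    ∑[ k < suc m ] (+ term m k)                     ≡⟨ ∑-cong (suc m) (λ k _ → pos-term k) ⟩
    binomSquareSum (+ d)                            ∎
    where
    open ≡-Reasoning
    term : ℕ → ℕ → ℕ
    term n k = (n C k) ℕ.* (n C k) ℕ.* d ℕ.^ k
    [p∸1]/2≡m : (m ℕ.+ m) ℕ./ 2 ≡ m
    [p∸1]/2≡m = trans (cong (ℕ._/ 2) (double m)) (ℕM.m*n/n≡m m 2)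
      where
      double : ∀ m → m ℕ.+ m ≡ m ℕ.* 2
      double = ℕ-Solver.solve-∀
    pos-term : ∀ k → + term m k ≡ + (m C k) * + (m C k) * (+ d) ^ k
    pos-term k = trans (ℤP.pos-* ((m C k) ℕ.* (m C k)) (d ℕ.^ k)) (cong₂ _*_ (ℤP.pos-* (m C k) (m C k)) (pos-^ d k))

  binomSquareSum-reciprocal : ∀ {e e′} → e * e′ ≈ 1ℤ → e ^ m * binomSquareSum e′ ≈ binomSquareSum e
  binomSquareSum-reciprocal {e} {e′} ee′≈1 = begin
    e ^ m * binomSquareSum e′                                  ≡⟨ ∑-*ˡ (suc m) (e ^ m) (λ k → c k * e′ ^ k) ⟨
    ∑[ k < suc m ] (e ^ m * (c k * e′ ^ k))                     ≈⟨ ≈-∑ (suc m) (λ k k≤m → term k (ℕP.≤-pred k≤m)) ⟩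
    ∑[ k < suc m ] (c (m ℕ.∸ k) * e ^ (m ℕ.∸ k))                ≡⟨ ∑-reverse (suc m) (λ j → c j * e ^ j) ⟨
    binomSquareSum e                                           ∎
    where
    open ≈-Reasoning
    c : ℕ → ℤ
    c k = + (m C k) * + (m C k)
    term : ∀ k → k ℕ.≤ m → e ^ m * (c k * e′ ^ k) ≈ c (m ℕ.∸ k) * e ^ (m ℕ.∸ k)
    term k k≤m = begin
      e ^ m * (c k * e′ ^ k)                       ≡⟨ cong (λ n → e ^ n * (c k * e′ ^ k)) (ℕP.m∸n+n≡m k≤m) ⟨
      e ^ (m ℕ.∸ k ℕ.+ k) * (c k * e′ ^ k)         ≡⟨ cong (_* (c k * e′ ^ k)) (ℤP.^-distribˡ-+-* e (m ℕ.∸ k) k) ⟩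
      e ^ (m ℕ.∸ k) * e ^ k * (c k * e′ ^ k)       ≡⟨ rearrange (e ^ (m ℕ.∸ k)) (e ^ k) (c k) (e′ ^ k) ⟩
      c k * e ^ (m ℕ.∸ k) * (e ^ k * e′ ^ k)       ≈⟨ ≈-*ˡ (c k * e ^ (m ℕ.∸ k)) (^-inverse ee′≈1 k) ⟩
      c k * e ^ (m ℕ.∸ k) * 1ℤ                     ≡⟨ ℤP.*-identityʳ _ ⟩
      c k * e ^ (m ℕ.∸ k)                          ≡⟨ cong (λ n → + n * + n * e ^ (m ℕ.∸ k)) (nCk≡nC[n∸k] k≤m) ⟩
      c (m ℕ.∸ k) * e ^ (m ℕ.∸ k)                  ∎
      where
      rearrange : ∀ a b c d → a * b * (c * d) ≡ c * a * (b * d)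
      rearrange = solve-∀

  binomSquareSum-reciprocal-≈0 : ∀ {e e′} → e * e′ ≈ 1ℤ → binomSquareSum e ≈ 0ℤ → binomSquareSum e′ ≈ 0ℤ
  binomSquareSum-reciprocal-≈0 {e} {e′} ee′≈1 T≈0 = begin
    binomSquareSum e′                              ≡⟨ ℤP.*-identityˡ _ ⟨
    1ℤ * binomSquareSum e′                         ≈⟨ ≈-* (≈-sym (^-inverse e′e≈1 m)) (≈-refl {binomSquareSum e′}) ⟩
    e′ ^ m * e ^ m * binomSquareSum e′             ≡⟨ ℤP.*-assoc (e′ ^ m) (e ^ m) _ ⟩
    e′ ^ m * (e ^ m * binomSquareSum e′)           ≈⟨ ≈-*ˡ (e′ ^ m) (≈-trans (binomSquareSum-reciprocal ee′≈1) T≈0) ⟩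
    e′ ^ m * 0ℤ                                    ≡⟨ ℤP.*-zeroʳ (e′ ^ m) ⟩
    0ℤ                                             ∎
    where
    open ≈-Reasoning
    e′e≈1 : e′ * e ≈ 1ℤ
    e′e≈1 = ≈-trans (≡⇒≈ (ℤP.*-comm e′ e)) ee′≈1

  module EdwardsCurve (d : ℕ) where

    u v : ℕ → ℤ
    u x = 1ℤ - + d * X x
    v x = 1ℤ - X x

    curve-lhs : ∀ x y → + (x ℕ.* x ℕ.+ y ℕ.* y) ≡ X x + X y
    curve-lhs x y = trans (ℤP.pos-+ (x ℕ.* x) (y ℕ.* y)) (cong₂ _+_ (ℤP.pos-* x x) (ℤP.pos-* y y))

    curve-rhs : ∀ x y → + (1 ℕ.+ d ℕ.* (x ℕ.* x) ℕ.* (y ℕ.* y)) ≡ 1ℤ + + d * X x * X y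
    curve-rhs x y = cong (_+_ 1ℤ) (trans (ℤP.pos-* (d ℕ.* (x ℕ.* x)) (y ℕ.* y))
      (cong₂ _*_ (trans (ℤP.pos-* d (x ℕ.* x)) (cong (+ d *_) (ℤP.pos-* x x))) (ℤP.pos-* y y)))

    uX-v≡lhs-rhs : ∀ x y → u x * X y - v x ≡ (X x + X y) - (1ℤ + + d * X x * X y)
    uX-v≡lhs-rhs x y = rearrange (+ d) (X x) (X y)
      where
      rearrange : ∀ e a b → (1ℤ - e * a) * b - (1ℤ - a) ≡ (a + b) - (1ℤ + e * a * b)
      rearrange = solve-∀

    onCurve⇒≈ : ∀ {x y} → y ℕ.< p → onCurve p d (x , y) → u x * X y ≈ v x
    onCurve⇒≈ {x} {y} _ eq = a-b≈0⇒a≈b (≈-trans (≡⇒≈ (uX-v≡lhs-rhs x y))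
      (a≈b⇒a-b≈0 (subst₂ _≈_ (curve-lhs x y) (curve-rhs x y) (%⇒≈ _ _ eq))))

    ≈⇒onCurve : ∀ {x y} → y ℕ.< p → u x * X y ≈ v x → onCurve p d (x , y)
    ≈⇒onCurve {x} {y} _ uX≈v = ≈⇒% _ _ (subst₂ _≈_ (sym (curve-lhs x y)) (sym (curve-rhs x y))
      (a-b≈0⇒a≈b (≈-trans (≡⇒≈ (sym (uX-v≡lhs-rhs x y))) (a≈b⇒a-b≈0 uX≈v))))

    module Fibre (x : ℕ) = Solutions (λ y → onCurve p d (x , y)) (λ y → onCurve? p d (x , y)) (u x) (v x)
                                     (onCurve⇒≈ {x}) (≈⇒onCurve {x})

    edwardsOrder≡∑ : edwardsOrder p d ≡ ∑ℕ[ x < p ] Fibre.count x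
    edwardsOrder≡∑ = length-filter-grid (onCurve? p d) p

    u≡ : ∀ x → u x ≡ (- + d) * X x + 1ℤ
    u≡ x = rearrange (+ d) (X x)
      where
      rearrange : ∀ a b → 1ℤ - a * b ≡ (- a) * b + 1ℤ
      rearrange = solve-∀

    v≡ : ∀ x → v x ≡ -1ℤ * X x + 1ℤ
    v≡ x = rearrange (X x)
      where
      rearrange : ∀ b → 1ℤ - b ≡ -1ℤ * b + 1ℤ
      rearrange = solve-∀

    ∑u^2m≈ : ¬ (+ d ≈ 0ℤ) → ∑[ x < p ] (u x ^ (m ℕ.+ m)) ≈ - (+ d) ^ m - 1ℤ
    ∑u^2m≈ d≉0 = begin
      ∑[ x < p ] (u x ^ (m ℕ.+ m))
        ≡⟨ ∑-cong p (λ x _ → trans (cong (_^ (m ℕ.+ m)) (u≡ x)) ([c*y+1]^n (- + d) (X x) (m ℕ.+ m))) ⟩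
      ∑[ x < p ] ∑[ k < suc (m ℕ.+ m) ] (f k * X x ^ k)      ≈⟨ ∑-polynomial f ⟩
      - f m - f (m ℕ.+ m)                                    ≈⟨ ≈-- (≈-neg f[m]≈d^m) f[2m]≈1 ⟩
      - (+ d) ^ m - 1ℤ                                       ∎
      where
      open ≈-Reasoning
      f : ℕ → ℤ
      f k = + ((m ℕ.+ m) C k) * (- + d) ^ k
      f[m]≈d^m : f m ≈ (+ d) ^ m
      f[m]≈d^m = begin
        + ((m ℕ.+ m) C m) * (- + d) ^ m           ≈⟨ ≈-* (C[2m,j]≈-1^j m (ℕP.m≤m+n m m)) (≈-refl {(- + d) ^ m}) ⟩
        -1ℤ ^ m * (- + d) ^ m                      ≡⟨ cong (-1ℤ ^ m *_) (-a^n≡-1^n*a^n (+ d) m) ⟩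
        -1ℤ ^ m * (-1ℤ ^ m * (+ d) ^ m)            ≡⟨ ℤP.*-assoc (-1ℤ ^ m) (-1ℤ ^ m) ((+ d) ^ m) ⟨
        -1ℤ ^ m * -1ℤ ^ m * (+ d) ^ m              ≡⟨ cong (_* (+ d) ^ m) (-1^n*-1^n≡1 m) ⟩
        1ℤ * (+ d) ^ m                             ≡⟨ ℤP.*-identityˡ _ ⟩
        (+ d) ^ m                                  ∎
      -d≈0⇒d≈0 : - + d ≈ 0ℤ → + d ≈ 0ℤ
      -d≈0⇒d≈0 = ≈-trans (≡⇒≈ (sym (ℤP.neg-involutive (+ d)))) ∘ ≈-neg
      f[2m]≈1 : f (m ℕ.+ m) ≈ 1ℤ
      f[2m]≈1 = begin
        + ((m ℕ.+ m) C (m ℕ.+ m)) * (- + d) ^ (m ℕ.+ m)  ≡⟨ cong (λ c → + c * (- + d) ^ (m ℕ.+ m)) (nCn≡1 (m ℕ.+ m)) ⟩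
        1ℤ * (- + d) ^ (m ℕ.+ m)                          ≡⟨ ℤP.*-identityˡ _ ⟩
        (- + d) ^ (m ℕ.+ m)                               ≈⟨ ≉0⇒^2m≈1 (d≉0 ∘ -d≈0⇒d≈0) ⟩
        1ℤ                                                ∎

    a b : ℕ → ℤ
    a i = + (m C i) * (- + d) ^ i
    b j = + (m C j) * -1ℤ ^ j

    [uv]^m≡ : ∀ x → (u x * v x) ^ m ≡ ∑[ i < suc m ] ∑[ j < suc m ] (a i * b j * X x ^ (i ℕ.+ j))
    [uv]^m≡ x = begin
      (u x * v x) ^ m                                                   ≡⟨ ^-distribʳ-* (u x) (v x) m ⟩
      u x ^ m * v x ^ m                                                 ≡⟨ cong₂ (λ s t → s ^ m * t ^ m) (u≡ x) (v≡ x) ⟩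
      ((- + d) * X x + 1ℤ) ^ m * (-1ℤ * X x + 1ℤ) ^ m
        ≡⟨ cong₂ _*_ ([c*y+1]^n (- + d) (X x) m) ([c*y+1]^n -1ℤ (X x) m) ⟩
      ∑[ i < suc m ] (a i * X x ^ i) * ∑[ j < suc m ] (b j * X x ^ j)
        ≡⟨ ∑-*-∑ (suc m) (suc m) (λ i → a i * X x ^ i) (λ j → b j * X x ^ j) ⟩
      ∑[ i < suc m ] ∑[ j < suc m ] (a i * X x ^ i * (b j * X x ^ j))
        ≡⟨ ∑-cong (suc m) (λ i _ → ∑-cong (suc m) (λ j _ → collect i j)) ⟩
      ∑[ i < suc m ] ∑[ j < suc m ] (a i * b j * X x ^ (i ℕ.+ j))       ∎
      where
      open ≡-Reasoning
      collect : ∀ i j → a i * X x ^ i * (b j * X x ^ j) ≡ a i * b j * X x ^ (i ℕ.+ j)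
      collect i j = trans (rearrange (a i) (b j) (X x ^ i) (X x ^ j)) (cong (a i * b j *_) (sym (ℤP.^-distribˡ-+-* (X x) i j)))
        where
        rearrange : ∀ a b s t → a * s * (b * t) ≡ a * b * (s * t)
        rearrange = solve-∀

    a*b[m∸i] : ∀ i → i ℕ.≤ m → a i * b (m ℕ.∸ i) ≡ -1ℤ ^ m * (+ (m C i) * + (m C i) * (+ d) ^ i)
    a*b[m∸i] i i≤m = begin
      + (m C i) * (- + d) ^ i * (+ (m C (m ℕ.∸ i)) * -1ℤ ^ (m ℕ.∸ i))
        ≡⟨ cong₂ (λ s t → + (m C i) * s * (+ t * -1ℤ ^ (m ℕ.∸ i))) (-a^n≡-1^n*a^n (+ d) i) (sym (nCk≡nC[n∸k] i≤m)) ⟩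
      + (m C i) * (-1ℤ ^ i * (+ d) ^ i) * (+ (m C i) * -1ℤ ^ (m ℕ.∸ i))
        ≡⟨ rearrange (+ (m C i)) (-1ℤ ^ i) ((+ d) ^ i) (-1ℤ ^ (m ℕ.∸ i)) ⟩
      -1ℤ ^ i * -1ℤ ^ (m ℕ.∸ i) * (+ (m C i) * + (m C i) * (+ d) ^ i)
        ≡⟨ cong (_* (+ (m C i) * + (m C i) * (+ d) ^ i))
                (trans (sym (ℤP.^-distribˡ-+-* -1ℤ i (m ℕ.∸ i))) (cong (-1ℤ ^_) (ℕP.m+[n∸m]≡n i≤m))) ⟩
      -1ℤ ^ m * (+ (m C i) * + (m C i) * (+ d) ^ i)
        ∎
      where
      open ≡-Reasoning
      rearrange : ∀ c s e t → c * (s * e) * (c * t) ≡ s * t * (c * c * e)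
      rearrange = solve-∀

    a[m]*b[m] : a m * b m ≡ (+ d) ^ m
    a[m]*b[m] = trans (cong (_* b m) (cong (_* (- + d) ^ m) (cong +_ (nCn≡1 m))))
                 (trans (cong (λ c → 1ℤ * (- + d) ^ m * (+ c * -1ℤ ^ m)) (nCn≡1 m)) (begin
      1ℤ * (- + d) ^ m * (1ℤ * -1ℤ ^ m)      ≡⟨ cong (λ z → 1ℤ * z * (1ℤ * -1ℤ ^ m)) (-a^n≡-1^n*a^n (+ d) m) ⟩
      1ℤ * (-1ℤ ^ m * (+ d) ^ m) * (1ℤ * -1ℤ ^ m) ≡⟨ rearrange (-1ℤ ^ m) ((+ d) ^ m) ⟩
      -1ℤ ^ m * -1ℤ ^ m * (+ d) ^ m          ≡⟨ cong (_* (+ d) ^ m) (-1^n*-1^n≡1 m) ⟩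
      1ℤ * (+ d) ^ m                         ≡⟨ ℤP.*-identityˡ _ ⟩
      (+ d) ^ m                              ∎))
      where
      open ≡-Reasoning
      rearrange : ∀ s e → 1ℤ * (s * e) * (1ℤ * s) ≡ s * s * e
      rearrange = solve-∀

    ∑[uv]^m≈ : ∑[ x < p ] ((u x * v x) ^ m) ≈ - (-1ℤ ^ m * binomSquareSum (+ d)) - (+ d) ^ m
    ∑[uv]^m≈ = begin
      ∑[ x < p ] ((u x * v x) ^ m)                                          ≡⟨ ∑-cong p (λ x _ → [uv]^m≡ x) ⟩
      ∑[ x < p ] ∑[ i < suc m ] ∑[ j < suc m ] (a i * b j * X x ^ (i ℕ.+ j)) ≈⟨ ∑-polynomial² (λ i j → a i * b j) ⟩
      - ∑[ i < suc m ] (a i * b (m ℕ.∸ i)) - a m * b m                      ≡⟨ cong₂ (λ s t → - s - t) antidiagonal a[m]*b[m] ⟩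
      - (-1ℤ ^ m * binomSquareSum (+ d)) - (+ d) ^ m                        ∎
      where
      open ≈-Reasoning
      antidiagonal : ∑[ i < suc m ] (a i * b (m ℕ.∸ i)) ≡ -1ℤ ^ m * binomSquareSum (+ d)
      antidiagonal = trans (∑-cong (suc m) (λ i i≤m → a*b[m∸i] i (ℕP.≤-pred i≤m)))
                           (∑-*ˡ (suc m) (-1ℤ ^ m) (λ i → + (m C i) * + (m C i) * (+ d) ^ i))

    edwardsOrder≈ : ¬ (+ d ≈ 0ℤ) →
      + edwardsOrder p d ≈ - (-1ℤ ^ m * binomSquareSum (+ d)) - (+ d) ^ m - (+ d) ^ m - 1ℤ
    edwardsOrder≈ d≉0 = begin
      + edwardsOrder p d                                          ≡⟨ cong +_ edwardsOrder≡∑ ⟩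
      + ∑ℕ[ x < p ] Fibre.count x                                 ≡⟨ ∑-pos p Fibre.count ⟩
      ∑[ x < p ] (+ Fibre.count x)                                ≈⟨ ≈-∑ p (λ x _ → Fibre.count≈ x) ⟩
      ∑[ x < p ] ((u x * v x) ^ m + u x ^ (m ℕ.+ m))              ≡⟨ ∑-+ p (λ x → (u x * v x) ^ m) (λ x → u x ^ (m ℕ.+ m)) ⟩
      ∑[ x < p ] ((u x * v x) ^ m) + ∑[ x < p ] (u x ^ (m ℕ.+ m)) ≈⟨ ≈-+ ∑[uv]^m≈ (∑u^2m≈ d≉0) ⟩
      - (-1ℤ ^ m * T) - (+ d) ^ m + (- (+ d) ^ m - 1ℤ)            ≡⟨ rearrange (-1ℤ ^ m * T) ((+ d) ^ m) ⟩
      - (-1ℤ ^ m * T) - (+ d) ^ m - (+ d) ^ m - 1ℤ                ∎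
      where
      open ≈-Reasoning
      T = binomSquareSum (+ d)
      rearrange : ∀ t e → - t - e + (- e - 1ℤ) ≡ - t - e - e - 1ℤ
      rearrange = solve-∀

    module _ (d≉0 : ¬ (+ d ≈ 0ℤ)) (d≉1 : ¬ (+ d ≈ 1ℤ)) (T≈0 : binomSquareSum (+ d) ≈ 0ℤ) where

      edwardsOrder≈-2d^m-1 : + edwardsOrder p d ≈ - (+ d) ^ m - (+ d) ^ m - 1ℤ
      edwardsOrder≈-2d^m-1 = ≈-trans (edwardsOrder≈ d≉0)
        (≈-trans (≈-- (≈-- (≈-- (≈-neg T-term≈0) ≈-refl) ≈-refl) ≈-refl) (≡⇒≈ (drop-0 ((+ d) ^ m))))
        where
        drop-0 : ∀ e → - 0ℤ - e - e - 1ℤ ≡ - e - e - 1ℤ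
        drop-0 = solve-∀
        T-term≈0 : -1ℤ ^ m * binomSquareSum (+ d) ≈ 0ℤ
        T-term≈0 = ≈-trans (≈-*ˡ (-1ℤ ^ m) T≈0) (≡⇒≈ (ℤP.*-zeroʳ (-1ℤ ^ m)))

      count≤2 : ∀ x → x ℕ.< p → Fibre.count x ℕ.≤ 2
      count≤2 x _ = Fibre.count≤2 x (λ u≈0 v≈0 → d≉1 (begin
        + d             ≡⟨ ℤP.*-identityʳ (+ d) ⟨
        + d * 1ℤ        ≈⟨ ≈-*ˡ (+ d) (a-b≈0⇒a≈b v≈0) ⟩
        + d * X x       ≈⟨ ≈-sym (a-b≈0⇒a≈b u≈0) ⟩
        1ℤ              ∎))
        where open ≈-Reasoning

      count≡1 : ∀ x → X x ≈ 1ℤ → Fibre.count x ≡ 1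
      count≡1 x X≈1 = ℕP.≤-antisym (Fibre.count≤1 x u≉0 v≈0) (Fibre.1≤count x v≈0)
        where
        v≈0 : v x ≈ 0ℤ
        v≈0 = ≈-- (≈-refl {1ℤ}) X≈1
        u≉0 : ¬ (u x ≈ 0ℤ)
        u≉0 u≈0 = d≉1 (≈-trans (≡⇒≈ (sym (ℤP.*-identityʳ (+ d))))
                               (≈-trans (≈-*ˡ (+ d) (≈-sym X≈1)) (≈-sym (a-b≈0⇒a≈b u≈0))))

      count≡0 : ∀ x → + d * X x ≈ 1ℤ → Fibre.count x ≡ 0
      count≡0 x dX≈1 = Fibre.count≡0 x u≈0 v≉0
        where
        u≈0 : u x ≈ 0ℤ
        u≈0 = ≈-- (≈-refl {1ℤ}) dX≈1
        v≉0 : ¬ (v x ≈ 0ℤ)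
        v≉0 v≈0 = d≉1 (≈-trans (≡⇒≈ (sym (ℤP.*-identityʳ (+ d)))) (≈-trans (≈-*ˡ (+ d) (a-b≈0⇒a≈b v≈0)) dX≈1))

      -- N ≡ 1; the fibres over x = 1 and x = p − 1 are {y = 0} and all others have at most
      -- two points, so 2 ≤ N ≤ 2p − 2.
      edwardsOrder-nonsquare : (+ d) ^ m ≈ -1ℤ → edwardsOrder p d ≡ p ℕ.+ 1
      edwardsOrder-nonsquare d^m≈-1 = ≈-window N≈p+1 N<p+1+p p+1<N+p
        where
        N = edwardsOrder p d
        N≈p+1 : + N ≈ + (p ℕ.+ 1)
        N≈p+1 = ≈-trans edwardsOrder≈-2d^m-1 (≈-trans (≈-- (≈-- (≈-neg d^m≈-1) d^m≈-1) (≈-refl {1ℤ}))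
                  (≈-trans (≈-+ (≈-sym p≈0) (≈-refl {1ℤ})) (≡⇒≈ (sym (ℤP.pos-+ p 1)))))
        1<p : 1 ℕ.< p
        1<p = s≤s 1≤2m
        1≢2m : 1 ≢ m ℕ.+ m
        1≢2m 1≡2m = ℕP.<-irrefl 1≡2m (ℕP.+-mono-≤ 1≤m 1≤m)
        X[2m]≈1 : X (m ℕ.+ m) ≈ 1ℤ
        X[2m]≈1 = ≈-* 2m≈-1 2m≈-1
        2≤N : 2 ℕ.≤ N
        2≤N = ℕP.≤-trans (ℕP.≤-reflexive (sym (cong₂ ℕ._+_ (count≡1 1 ≈-refl) (count≡1 (m ℕ.+ m) X[2m]≈1))))
               (ℕP.≤-trans (twoPoints-≤-∑ℕ Fibre.count p 1<p (ℕP.n<1+n (m ℕ.+ m)) 1≢2m)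
                           (ℕP.≤-reflexive (sym edwardsOrder≡∑)))
        N+4≤2p+2 : N ℕ.+ 4 ℕ.≤ p ℕ.* 2 ℕ.+ 2
        N+4≤2p+2 = subst₂ ℕ._≤_ (cong (ℕ._+ 4) (sym edwardsOrder≡∑))
                     (cong (p ℕ.* 2 ℕ.+_) (cong₂ ℕ._+_ (count≡1 1 ≈-refl) (count≡1 (m ℕ.+ m) X[2m]≈1)))
                     (∑ℕ-≤2-twoPoints Fibre.count p 1<p (ℕP.n<1+n (m ℕ.+ m)) 1≢2m count≤2)
        N<p+1+p : N ℕ.< p ℕ.+ 1 ℕ.+ p
        N<p+1+p = ℕP.≤-trans (ℕP.m≤m+n (suc N) 2)
                    (ℕP.+-cancelʳ-≤ 1 (suc N ℕ.+ 2) (p ℕ.+ 1 ℕ.+ p) (subst₂ ℕ._≤_ (shift₁ N) (shift₂ p) N+4≤2p+2))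
          where
          shift₁ : ∀ n → n ℕ.+ 4 ≡ suc n ℕ.+ 2 ℕ.+ 1
          shift₁ = ℕ-Solver.solve-∀
          shift₂ : ∀ p → p ℕ.* 2 ℕ.+ 2 ≡ p ℕ.+ 1 ℕ.+ p ℕ.+ 1
          shift₂ = ℕ-Solver.solve-∀
        p+1<N+p : p ℕ.+ 1 ℕ.< N ℕ.+ p
        p+1<N+p = subst (ℕ._≤ N ℕ.+ p) (cong suc (ℕP.+-comm 1 p)) (ℕP.+-monoˡ-≤ p 2≤N)

      -- N ≡ −3 and the fibres over ±x₀ are empty, so N ≤ 2p − 4.
      edwardsOrder-square : (+ d) ^ m ≈ 1ℤ → ∀ {x₀} → x₀ ℕ.< p → + d * X x₀ ≈ 1ℤ → edwardsOrder p d ≡ p ℕ.∸ 3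
      edwardsOrder-square d^m≈1 {x₀} x₀<p dX₀≈1 = ≈-window N≈p-3 N<p-3+p p-3<N+p
        where
        N = edwardsOrder p d
        3≤p : 3 ℕ.≤ p
        3≤p = s≤s (ℕP.+-mono-≤ 1≤m 1≤m)
        N≈p-3 : + N ≈ + (p ℕ.∸ 3)
        N≈p-3 = ≈-trans edwardsOrder≈-2d^m-1 (≈-trans (≈-- (≈-- (≈-neg d^m≈1) d^m≈1) (≈-refl {1ℤ}))
                  (≈-trans (≈-- (≈-sym p≈0) (≈-refl {+ 3})) (≡⇒≈ (sym (pos-∸ 3≤p)))))
        x₀≢0 : x₀ ≢ 0
        x₀≢0 refl with residue-injective {0} {1} (s≤s z≤n) (s≤s 1≤2m) (≈-trans (≡⇒≈ (sym (ℤP.*-zeroʳ (+ d)))) dX₀≈1)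
        ... | ()
        x₁ = p ℕ.∸ x₀
        x₁<p : x₁ ℕ.< p
        x₁<p = ℕP.∸-monoʳ-< (ℕP.n≢0⇒n>0 x₀≢0) (ℕP.<⇒≤ x₀<p)
        x₀≢x₁ : x₀ ≢ x₁
        x₀≢x₁ x₀≡x₁ = odd≢even m x₀ (trans (sym (ℕP.m+[n∸m]≡n (ℕP.<⇒≤ x₀<p))) (cong (x₀ ℕ.+_) (sym x₀≡x₁)))
        dX₁≈1 : + d * X x₁ ≈ 1ℤ
        dX₁≈1 = ≈-trans (≈-*ˡ (+ d) (X-∸ (ℕP.<⇒≤ x₀<p))) dX₀≈1
        N+4≤2p : N ℕ.+ 4 ℕ.≤ p ℕ.* 2
        N+4≤2p = subst₂ ℕ._≤_ (cong (ℕ._+ 4) (sym edwardsOrder≡∑))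
                   (trans (cong (p ℕ.* 2 ℕ.+_) (cong₂ ℕ._+_ (count≡0 x₀ dX₀≈1) (count≡0 x₁ dX₁≈1)))
                          (ℕP.+-identityʳ (p ℕ.* 2)))
                   (∑ℕ-≤2-twoPoints Fibre.count p x₀<p x₁<p x₀≢x₁ count≤2)
        N<p-3+p : N ℕ.< p ℕ.∸ 3 ℕ.+ p
        N<p-3+p = ℕP.+-cancelʳ-≤ 3 (suc N) (p ℕ.∸ 3 ℕ.+ p) (subst₂ ℕ._≤_ (shift N) (sym 2p≡) N+4≤2p)
          where
          shift : ∀ n → n ℕ.+ 4 ≡ suc n ℕ.+ 3
          shift = ℕ-Solver.solve-∀
          2p≡ : p ℕ.∸ 3 ℕ.+ p ℕ.+ 3 ≡ p ℕ.* 2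
          2p≡ = trans (cong (λ z → p ℕ.∸ 3 ℕ.+ z ℕ.+ 3) (sym p∸3+3≡p)) (trans (double (p ℕ.∸ 3)) (cong (ℕ._* 2) p∸3+3≡p))
            where
            p∸3+3≡p : p ℕ.∸ 3 ℕ.+ 3 ≡ p
            p∸3+3≡p = ℕP.m∸n+n≡m 3≤p
            double : ∀ q → q ℕ.+ (q ℕ.+ 3) ℕ.+ 3 ≡ (q ℕ.+ 3) ℕ.* 2
            double = ℕ-Solver.solve-∀
        p-3<N+p : p ℕ.∸ 3 ℕ.< N ℕ.+ p
        p-3<N+p = ℕP.<-≤-trans (ℕP.∸-monoʳ-< {p} {3} {0} (s≤s z≤n) 3≤p) (ℕP.m≤n+m p N)

  module _ {d d′ : ℕ} (d<p : d ℕ.< p) (d≢0 : d ≢ 0) (d≢1 : d ≢ 1) (dd′≈1 : + d * + d′ ≈ 1ℤ)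
           (T≈0 : binomSquareSum (+ d) ≈ 0ℤ) where

    private
      d≉0 : ¬ (+ d ≈ 0ℤ)
      d≉0 = d≢0 ∘ residue-injective d<p (s≤s z≤n)
      d≉1 : ¬ (+ d ≈ 1ℤ)
      d≉1 = d≢1 ∘ residue-injective d<p (s≤s 1≤2m)
      d′d≈1 : + d′ * + d ≈ 1ℤ
      d′d≈1 = ≈-trans (≡⇒≈ (ℤP.*-comm (+ d′) (+ d))) dd′≈1
      d′≉0 : ¬ (+ d′ ≈ 0ℤ)
      d′≉0 d′≈0 = 1≉0 (≈-trans (≈-sym dd′≈1) (≈-trans (≈-*ˡ (+ d) d′≈0) (≡⇒≈ (ℤP.*-zeroʳ (+ d)))))
        where
        1≉0 : ¬ (1ℤ ≈ 0ℤ)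
        1≉0 = nonzero-residue (s≤s z≤n) (s≤s 1≤2m)
      d′≉1 : ¬ (+ d′ ≈ 1ℤ)
      d′≉1 d′≈1 = d≉1 (≈-trans (≡⇒≈ (sym (ℤP.*-identityʳ (+ d)))) (≈-trans (≈-*ˡ (+ d) (≈-sym d′≈1)) dd′≈1))
      T′≈0 : binomSquareSum (+ d′) ≈ 0ℤ
      T′≈0 = binomSquareSum-reciprocal-≈0 {+ d} {+ d′} dd′≈1 T≈0
      module E  = EdwardsCurve d
      module E′ = EdwardsCurve d′

    edwardsOrders-nonsquare : ¬ IsSquare p d → edwardsOrder p d ≡ p ℕ.+ 1 × edwardsOrder p d′ ≡ p ℕ.+ 1
    edwardsOrders-nonsquare nonsquare =
      E.edwardsOrder-nonsquare d≉0 d≉1 T≈0 d^m≈-1 ,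
      E′.edwardsOrder-nonsquare d′≉0 d′≉1 T′≈0 (^-reciprocal {+ d} {+ d′} m dd′≈1 refl d^m≈-1)
      where
      d^m≈-1 = euler-nonsquare nonsquare

    -- If d ≡ t², then x₀ = d′ t satisfies d x₀² ≡ 1, and t satisfies d′ t² ≡ 1.
    edwardsOrders-square : IsSquare p d → edwardsOrder p d ≡ p ℕ.∸ 3 × edwardsOrder p d′ ≡ p ℕ.∸ 3
    edwardsOrders-square sq@(t , t<p , _) =
      E.edwardsOrder-square d≉0 d≉1 T≈0 d^m≈1 (ℕM.m%n<n (d′ ℕ.* t) p) dX₀≈1 ,
      E′.edwardsOrder-square d′≉0 d′≉1 T′≈0 (^-reciprocal {+ d} {+ d′} m dd′≈1 refl d^m≈1) t<p d′X[t]≈1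
      where
      d^m≈1 = euler-square d≉0 sq
      d′X[t]≈1 : + d′ * X t ≈ 1ℤ
      d′X[t]≈1 = ≈-trans (≈-*ˡ (+ d′) (X-root sq)) d′d≈1
      x₀≈d′t : + ((d′ ℕ.* t) ℕ.% p) ≈ + d′ * + t
      x₀≈d′t = ≈-trans (%⇒≈ _ (d′ ℕ.* t) (ℕM.m%n%n≡m%n (d′ ℕ.* t) p)) (≡⇒≈ (ℤP.pos-* d′ t))
      dX₀≈1 : + d * X ((d′ ℕ.* t) ℕ.% p) ≈ 1ℤ
      dX₀≈1 = begin
        + d * X ((d′ ℕ.* t) ℕ.% p)               ≈⟨ ≈-*ˡ (+ d) (≈-* x₀≈d′t x₀≈d′t) ⟩
        + d * (+ d′ * + t * (+ d′ * + t))        ≡⟨ rearrange (+ d) (+ d′) (+ t) ⟩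
        + d * + d′ * (+ d′ * X t)                ≈⟨ ≈-* dd′≈1 d′X[t]≈1 ⟩
        1ℤ * 1ℤ                                  ≡⟨⟩
        1ℤ                                       ∎
        where
        open ≈-Reasoning
        rearrange : ∀ a b c → a * (b * c * (b * c)) ≡ a * b * (b * (c * c))
        rearrange = solve-∀

p%4≡3⇒p≡1+2m : ∀ p → p ℕ.% 4 ≡ 3 → ∃[ m ] (1 ℕ.≤ m × p ≡ suc (m ℕ.+ m))
p%4≡3⇒p≡1+2m p p%4≡3 =
  suc (q ℕ.+ q) , s≤s z≤n , trans (ℕM.m≡m%n+[m/n]*n p 4) (trans (cong (ℕ._+ q ℕ.* 4) p%4≡3) (regroup q))
  where
  q = p ℕ./ 4
  regroup : ∀ q → 3 ℕ.+ q ℕ.* 4 ≡ suc (suc (q ℕ.+ q) ℕ.+ suc (q ℕ.+ q))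
  regroup = ℕ-Solver.solve-∀

theorem1 : (p : ℕ) .{{_ : NonZero p}} → Prime p → p ℕ.% 4 ≡ 3 →
    (d : ℕ) → d ℕ.< p → d ≢ 0 → d ≢ 1 →
    (dinv : ℕ) → dinv ℕ.< p → (d ℕ.* dinv) ℕ.% p ≡ 1 →
    binomSum p d ℕ.% p ≡ 0 →
    ((¬ IsSquare p d) → edwardsOrder p d ≡ p ℕ.+ 1 × edwardsOrder p dinv ≡ p ℕ.+ 1)
    × (IsSquare p d → edwardsOrder p d ≡ p ℕ.∸ 3 × edwardsOrder p dinv ≡ p ℕ.∸ 3)
theorem1 p p-prime p%4≡3 d d<p d≢0 d≢1 dinv _ dd⁻¹%p≡1 binomSum%p≡0 with p%4≡3⇒p≡1+2m p p%4≡3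
... | m , 1≤m , refl = edwardsOrders-nonsquare d<p d≢0 d≢1 dd⁻¹≈1 T≈0 , edwardsOrders-square d<p d≢0 d≢1 dd⁻¹≈1 T≈0
  where
  open OddPrime m 1≤m p-prime hiding (p)
  dd⁻¹≈1 : + d * + dinv ≈ 1ℤ
  dd⁻¹≈1 = ≈-trans (≡⇒≈ (sym (ℤP.pos-* d dinv)))
                   (%⇒≈ (d ℕ.* dinv) 1 (trans dd⁻¹%p≡1 (sym (ℕM.m<n⇒m%n≡m (s≤s 1≤2m)))))
  T≈0 : binomSquareSum (+ d) ≈ 0ℤ
  T≈0 = ≈-trans (≡⇒≈ (sym (binomSum≡binomSquareSum d))) (%⇒≈ (binomSum p d) 0 binomSum%p≡0)
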